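{- Let $G$ be an embedded graph in an oriented surface, with a checkerboard colouring of its faces (faces coloured black and white so that faces sharing an edge have different colours). Then \[ P(G;\lambda)=(-1)^{f(G)}\, j(\vec{G}_m^P;-\lambda), \] where $f(G)$ is the number of faces of $G$.
   Context: The medial graph $G_m$ has a degree-4 vertex $v_e$ on each edge $e$ of $G$, with edges following the face boundaries of $G$ (an isolated vertex contributes a vertex-free closed curve); faces of $G_m$ containing a vertex of $G$ are coloured black, others white (canonical colouring). At $v_e$: the white split pairs consecutive half-edges bounding white corners, the black split those bounding black corners, the crossing pairs opposite half-edges. A state $s$ chooses a vertex state at each vertex; $c(s)$ = number of resulting closed curves, $cr(s)$ = number of crossings; Penrose states have no black split; the Penrose polynomial is $P(G;\lambda)=\sum_{s\text{ Penrose}}(-1)^{cr(s)}\lambda^{c(s)}$. The Penrose directed medial graph $\vec{G}_m^P$ is $G_m$ with each edge directed (using the orientation of the surface) clockwise as it follows the boundary of a white face of $G$ and counterclockwise as it follows a black face of $G$ (colours from the given checkerboard colouring of $G$). For a 4-regular Eulerian digraph $\vec{H}$, the circuit partition polynomial is $j(\vec{H};x)=\sum_s x^{c(s)}$, summed over the states $s$ of the underlying graph in which, at every vertex, each of the two pairs consists of one incoming and one outgoing half-edge. -}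

module Defs where

open import Data.Nat as ℕ using (ℕ; zero; suc; _⊓_; _≤ᵇ_; _≡ᵇ_; _<ᵇ_)
open import Data.Fin as F using (Fin; toℕ; _↑ˡ_; _↑ʳ_; splitAt)
open import Data.Fin.Permutation using (Permutation′; _⟨$⟩ʳ_; _⟨$⟩ˡ_)
open import Data.Bool using (Bool; true; false; not; _∧_; _xor_; if_then_else_)
open import Data.Sum using (_⊎_; inj₁; inj₂)
open import Data.List using (List; []; _∷_; [_]; map; concatMap; allFin; upTo; foldr)
open import Data.Integer as ℤ using (ℤ)
open import Relation.Nullary using (¬_; ⌊_⌋)
open import Relation.Binary.PropositionalEquality using (_≡_)

all : {A : Set} → (A → Bool) → List A → Bool
all p = foldr (λ a acc → p a ∧ acc) true

count : (N : ℕ) → (Fin N → Bool) → ℕ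
count N p = foldr (λ x acc → if p x then suc acc else acc) 0 (allFin N)

sumℤ : {A : Set} → List A → (A → ℤ) → ℤ
sumℤ xs f = foldr (λ a acc → f a ℤ.+ acc) ℤ.0ℤ xs

-- all functions Fin n → A whose values are drawn from the list vs
-- (each function listed exactly once, up to pointwise equality)
allFuns : {A : Set} → (n : ℕ) → List A → List (Fin n → A)
allFuns zero    vs = [ (λ ()) ]
allFuns (suc n) vs =
  concatMap (λ f → map (λ a → cons a f) vs) (allFuns n vs)
  where
  cons : _ → (Fin n → _) → Fin (suc n) → _
  cons a f F.zero    = a
  cons a f (F.suc i) = f i

iter : {A : Set} → ℕ → (A → A) → A → A
iter zero    f x = x
iter (suc k) f x = f (iter k f x)

_==_ : {N : ℕ} → Fin N → Fin N → Bool
a == b = ⌊ a F.≟ b ⌋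

-- number of orbits of a permutation f of Fin N
-- (= number of x that are least in their orbit {f^k x | k < N})
orbits : (N : ℕ) → (Fin N → Fin N) → ℕ
orbits N f = count N (λ x → all (λ k → toℕ x ≤ᵇ toℕ (iter k f x)) (upTo N))

-- Number of closed curves obtained from a set of half-edges Fin N with
-- the edge pairing μ and the vertex-state pairing τ (both fixed-point-free
-- involutions): the number of orbits of the group ⟨μ, τ⟩, where the orbit
-- of x is {(μτ)^k x, τ (μτ)^k x | k < N}.
curves : (N : ℕ) → (Fin N → Fin N) → (Fin N → Fin N) → ℕ
curves N μ τ = count N (λ x → all (λ k →
    (toℕ x ≤ᵇ toℕ (iter k (λ y → μ (τ y)) x))
  ∧ (toℕ x ≤ᵇ toℕ (τ (iter k (λ y → μ (τ y)) x)))) (upTo N))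

record Digraph4 : Set where
  field
    N         : ℕ               -- half-edges
    vx        : Fin N → ℕ       -- the vertex each half-edge is incident with
    μ         : Fin N → Fin N   -- pairing of half-edges into edges
    out       : Fin N → Bool    -- true iff the half-edge is directed away from its vertex
    freeLoops : ℕ               -- number of vertex-free closed curves (components)

open Digraph4

-- a state of the underlying graph: at every vertex its (four) half-edges are
-- paired into two pairs, i.e. a fixed-point-free involution τ preserving vertices
isState : (D : Digraph4) → (Fin (N D) → Fin (N D)) → Bool
isState D τ = all (λ x → (τ (τ x) == x) ∧ not (τ x == x) ∧ (vx D (τ x) ≡ᵇ vx D x))
                  (allFin (N D))

isDirState : (D : Digraph4) → (Fin (N D) → Fin (N D)) → Bool
isDirState D τ = all (λ x → out D (τ x) xor out D x) (allFin (N D))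

circuitPartition : Digraph4 → ℤ → ℤ
circuitPartition D x =
  sumℤ (allFuns (N D) (allFin (N D)))
       (λ τ → if isState D τ ∧ isDirState D τ
              then x ℤ.^ (curves (N D) (μ D) τ ℕ.+ freeLoops D)
              else ℤ.0ℤ)

-- Embedded graphs in oriented surfaces, as oriented combinatorial maps
-- (ribbon graphs): darts Fin n, edge involution α, rotation σ giving the
-- counterclockwise cyclic order of darts at each vertex, plus a number of
-- isolated vertices.

record EmbeddedGraph : Set where
  field
    n        : ℕ
    α        : Fin n → Fin n
    α-invol  : ∀ d → α (α d) ≡ d
    α-fpf    : ∀ d → ¬ (α d ≡ d)
    σ        : Permutation′ n
    isolated : ℕ

open EmbeddedGraph

σ⁺ σ⁻ : (G : EmbeddedGraph) → Fin (n G) → Fin (n G)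
σ⁺ G d = σ G ⟨$⟩ʳ d
σ⁻ G d = σ G ⟨$⟩ˡ d

-- Dart d also names the corner (d, σ d) of G.  The corners of a face, read
-- clockwise, form an orbit of d ↦ α (σ d).  Faces = these orbits, plus one
-- face for each isolated vertex.
faces : EmbeddedGraph → ℕ
faces G = orbits (n G) (λ d → α G (σ⁺ G d)) ℕ.+ isolated G

-- Colours: true = black, false = white.  A colouring of the faces is given as
-- a colouring of the corners that is constant along faces.  The two faces
-- on either side of the edge of dart d contain the corners d and σ⁻¹ d.
-- (The colour of the face of an isolated vertex plays no role.)
record IsCheckerboard (G : EmbeddedGraph) (col : Fin (n G) → Bool) : Set where
  field
    constOnFaces : ∀ d → col (α G (σ⁺ G d)) ≡ col d
    alternates   : ∀ d → ¬ (col (σ⁻ G d) ≡ col d)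

-- Vertex v_e for each edge e = {d, α d}.  Its half-edges are
-- (d, after) = d ↑ˡ n  (end of the medial edge of corner (d, σ d)) and
-- (d, before) = n ↑ʳ d (end of the medial edge of corner (σ⁻¹ d, d)).

module _ (G : EmbeddedGraph) where
  private
    m = n G

  after before : Fin m → Fin (m ℕ.+ m)
  after  d = d ↑ˡ m
  before d = m ↑ʳ d

  -- medial edges: corner d joins (d, after) and (σ d, before)
  medialμ : Fin (m ℕ.+ m) → Fin (m ℕ.+ m)
  medialμ h with splitAt m h
  ... | inj₁ d = before (σ⁺ G d)
  ... | inj₂ d = after (σ⁻ G d)

  medialVx : Fin (m ℕ.+ m) → ℕ
  medialVx h with splitAt m h
  ... | inj₁ d = toℕ d ⊓ toℕ (α G d)
  ... | inj₂ d = toℕ d ⊓ toℕ (α G d)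

  -- Vertex states at v_e.  White split: pairs the half-edges bounding the
  -- white corners (faces of G):  (d,after)–(αd,before), (d,before)–(αd,after).
  whiteSplit : Fin (m ℕ.+ m) → Fin (m ℕ.+ m)
  whiteSplit h with splitAt m h
  ... | inj₁ d = before (α G d)
  ... | inj₂ d = after (α G d)

  -- Crossing: pairs opposite half-edges (d,after)–(αd,after), (d,before)–(αd,before).
  crossing : Fin (m ℕ.+ m) → Fin (m ℕ.+ m)
  crossing h with splitAt m h
  ... | inj₁ d = after (α G d)
  ... | inj₂ d = before (α G d)

  -- A Penrose state: at each edge choose crossing (true) or white split (false),
  -- given on darts and constant on edges.
  IsEdgeFunction : (Fin m → Bool) → Bool
  IsEdgeFunction s = all (λ d → not (s (α G d) xor s d)) (allFin m)

  penroseτ : (Fin m → Bool) → Fin (m ℕ.+ m) → Fin (m ℕ.+ m)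
  penroseτ s h with splitAt m h
  ... | inj₁ d = if s d then crossing h else whiteSplit h
  ... | inj₂ d = if s d then crossing h else whiteSplit h

  cr : (Fin m → Bool) → ℕ
  cr s = count m (λ d → s d ∧ (toℕ d <ᵇ toℕ (α G d)))

  c : (Fin m → Bool) → ℕ
  c s = curves (m ℕ.+ m) medialμ (penroseτ s) ℕ.+ isolated G

  penrose : ℤ → ℤ
  penrose x =
    sumℤ (allFuns m (false ∷ true ∷ []))
         (λ s → if IsEdgeFunction s
                then (ℤ.-1ℤ ℤ.^ cr s) ℤ.* (x ℤ.^ c s)
                else ℤ.0ℤ)

  -- Penrose directed medial graph: the medial edge of corner d lies in the
  -- face of G containing corner d and runs from (d, after) to (σ d, before)
  -- in the clockwise direction of that face; it is directed that way iff the
  -- face is white, and the other way iff it is black.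
  penroseMedial : (Fin m → Bool) → Digraph4
  penroseMedial col = record
    { N         = m ℕ.+ m
    ; vx        = medialVx
    ; μ         = medialμ
    ; out       = outP
    ; freeLoops = isolated G
    }
    where
    outP : Fin (m ℕ.+ m) → Bool
    outP h with splitAt m h
    ... | inj₁ d = not (col d)          -- tail of medial edge of corner d iff white
    ... | inj₂ d = col (σ⁻ G d)         -- head of medial edge of corner σ⁻¹ d iff black

-- With the
-- Penrose orientation of the medial graph both choices pair an incoming with an
-- outgoing half-edge, and conversely every state of the directed medial graph with
-- this property is the state of exactly one s; hence j(G⃗ₘᴾ; -λ) = Σₛ (-λ)^c(s), and
-- it remains to show c(s) + cr(s) ≡ f(G) (mod 2).  Following a curve of s along the
-- directed medial graph from one medial edge to the next defines a permutation ρ of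
-- the corners of G whose cycles are the curves.  In the all-white state the cycles
-- of ρ are the faces of G, and turning one white split into a crossing composes ρ
-- with a transposition, which changes the number of cycles by one while cr(s)
-- changes by one.

module Submission where

open import Defs
open import Level using (0ℓ)
open import Data.Nat as ℕ using (ℕ; zero; suc; _+_; _∸_; _≤_; _<_; z≤n; s≤s; _≤ᵇ_; _<ᵇ_; _≡ᵇ_; _⊓_; parity)
import Data.Nat.Properties as ℕ
open import Data.Nat.DivMod using (_%_; _/_; m≡m%n+[m/n]*n; m%n<n)
open import Data.Parity as ℙ using (Parity; 0ℙ; 1ℙ)
import Data.Parity.Properties as ℙ
open import Data.Integer as ℤ using (ℤ; 0ℤ; 1ℤ; -1ℤ; _*_; _^_; -_) renaming (_+_ to _+ℤ_)
import Data.Integer.Properties as ℤ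
open import Data.Integer.Solver using (module +-*-Solver)
open import Data.Fin as F using (Fin; toℕ; fromℕ<; splitAt)
import Data.Fin.Properties as F
open import Data.Fin.Permutation using (inverseˡ; inverseʳ)
open import Data.Fin.Permutation.Components using (transpose)
open import Data.Bool using (Bool; true; false; not; _∧_; _∨_; _xor_; if_then_else_)
import Data.Bool as Bool
open import Data.Bool.Properties
  using (∧-conicalˡ; ∧-conicalʳ; ∧-zeroʳ; ∧-identityʳ; ∨-comm; ∨-zeroʳ; T-≡; not-involutive; not-injective; ¬-not;
         xor-same; not-distribˡ-xor; if-∧)
open import Data.List using (List; []; _∷_; _++_; foldr; map; concatMap; tabulate; applyUpTo; upTo; allFin)
open import Data.Product using (Σ; ∃; _×_; _,_; proj₁; proj₂)
import Data.Product as Product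
open import Data.Sum using (_⊎_; inj₁; inj₂; [_,_]′)
import Data.Sum as Sum
open import Data.Empty using (⊥-elim)
open import Function using (_∘_; id; _⇔_; Equivalence; mk⇔)
open import Relation.Nullary using (¬_; Dec; does; yes; no)
open import Relation.Nullary.Decidable using (dec-true; dec-false; does-≡; map′; isYes≗does; toWitness; ⌊⌋-map′)
open import Relation.Nullary.Negation using (contradiction)
open import Relation.Unary using (Decidable)
open import Relation.Binary using (Rel; IsDecEquivalence; Tri; tri<; tri≈; tri>)
open import Relation.Binary.Definitions using (DecidableEquality)
open import Relation.Binary.PropositionalEquality
open import Algebra.Properties.CommutativeMonoid.Sum ℕ.+-0-commutativeMonoid
  using (sum-syntax; ∑-comm; ∑-distrib-+; sum-cong-≗; sum-replicate-zero)
import Algebra.Properties.CommutativeMonoid.Sum ℤ.+-0-commutativeMonoid as ℤΣ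
open import Algebra.Properties.CommutativeSemigroup ℤ.+-commutativeSemigroup using (interchange)
open import Algebra.Properties.CommutativeSemigroup ℕ.+-commutativeSemigroup using (xy∙z≈xz∙y)

bool-ext : {a b : Bool} → (a ≡ true → b ≡ true) → (b ≡ true → a ≡ true) → a ≡ b
bool-ext {false} {false} _ _ = refl
bool-ext {false} {true}  _ g = g refl
bool-ext {true}  {false} f _ = sym (f refl)
bool-ext {true}  {true}  _ _ = refl

≢true⇒≡false : {a : Bool} → ¬ a ≡ true → a ≡ false
≢true⇒≡false {false} _ = refl
≢true⇒≡false {true}  f = ⊥-elim (f refl)

==⇒≡ : ∀ {n} {a b : Fin n} → (a == b) ≡ true → a ≡ b
==⇒≡ e = toWitness (Equivalence.from T-≡ e)

≡⇒== : ∀ {n} {a b : Fin n} → a ≡ b → (a == b) ≡ true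
≡⇒== {a = a} {b} e = trans (isYes≗does (a F.≟ b)) (dec-true (a F.≟ b) e)

≢⇒==false : ∀ {n} {a b : Fin n} → a ≢ b → (a == b) ≡ false
≢⇒==false {a = a} {b} ne = trans (isYes≗does (a F.≟ b)) (dec-false (a F.≟ b) ne)

≤ᵇ⇒≤ : ∀ {m n} → (m ≤ᵇ n) ≡ true → m ≤ n
≤ᵇ⇒≤ {m} {n} e = ℕ.≤ᵇ⇒≤ m n (Equivalence.from T-≡ e)

≤⇒≤ᵇ : ∀ {m n} → m ≤ n → (m ≤ᵇ n) ≡ true
≤⇒≤ᵇ le = Equivalence.to T-≡ (ℕ.≤⇒≤ᵇ le)

all-cong : ∀ {A : Set} {p q : A → Bool} → (∀ x → p x ≡ q x) → ∀ xs → all p xs ≡ all q xs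
all-cong p≗q []       = refl
all-cong p≗q (x ∷ xs) = cong₂ _∧_ (p≗q x) (all-cong p≗q xs)

<ᵇ⇒< : ∀ {m n} → (m ℕ.<ᵇ n) ≡ true → m < n
<ᵇ⇒< {m} {n} e = ℕ.<ᵇ⇒< m n (Equivalence.from T-≡ e)

<⇒<ᵇ : ∀ {m n} → m < n → (m ℕ.<ᵇ n) ≡ true
<⇒<ᵇ lt = Equivalence.to T-≡ (ℕ.<⇒<ᵇ lt)

xor⇒≢ : ∀ {a b} → a xor b ≡ true → a ≢ b
xor⇒≢ {a} e refl = contradiction (trans (sym e) (xor-same a)) λ ()

not-xor-self : ∀ b → not b xor b ≡ true
not-xor-self b = trans (sym (not-distribˡ-xor b b)) (cong not (xor-same b))

≡ᵇ-refl : ∀ k → (k ≡ᵇ k) ≡ true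
≡ᵇ-refl k = Equivalence.to T-≡ (ℕ.≡⇒≡ᵇ k k refl)

all-allFin : ∀ {n} (p : Fin n → Bool) → all p (allFin n) ≡ true ⇔ (∀ i → p i ≡ true)
all-allFin {n} p = mk⇔ (to n id) (from n id)
  where
  to : ∀ {A : Set} {p : A → Bool} n (f : Fin n → A) → all p (tabulate f) ≡ true → ∀ i → p (f i) ≡ true
  to (suc n) f e F.zero    = ∧-conicalˡ _ _ e
  to (suc n) f e (F.suc i) = to n (f ∘ F.suc) (∧-conicalʳ _ _ e) i
  from : ∀ {A : Set} {p : A → Bool} n (f : Fin n → A) → (∀ i → p (f i) ≡ true) → all p (tabulate f) ≡ true
  from zero    f h = refl
  from (suc n) f h = cong₂ _∧_ (h F.zero) (from n (f ∘ F.suc) (h ∘ F.suc))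

all-upTo : ∀ n (p : ℕ → Bool) → all p (upTo n) ≡ true ⇔ (∀ k → k < n → p k ≡ true)
all-upTo n p = mk⇔ (to n id) (from n id)
  where
  to : ∀ n (f : ℕ → ℕ) → all p (applyUpTo f n) ≡ true → ∀ k → k < n → p (f k) ≡ true
  to (suc n) f e zero    _         = ∧-conicalˡ _ _ e
  to (suc n) f e (suc k) (s≤s k<n) = to n (f ∘ suc) (∧-conicalʳ _ _ e) k k<n
  from : ∀ n (f : ℕ → ℕ) → (∀ k → k < n → p (f k) ≡ true) → all p (applyUpTo f n) ≡ true
  from zero    f h = refl
  from (suc n) f h = cong₂ _∧_ (h 0 (s≤s z≤n)) (from n (f ∘ suc) (λ k k<n → h (suc k) (s≤s k<n)))

indicator : Bool → ℕ
indicator b = if b then 1 else 0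

count≡∑ : ∀ N (p : Fin N → Bool) → count N p ≡ ∑[ x < N ] indicator (p x)
count≡∑ N p = go N id
  where
  go : ∀ n (f : Fin n → Fin N) →
    foldr (λ x acc → if p x then suc acc else acc) 0 (tabulate f) ≡ ∑[ i < n ] indicator (p (f i))
  go zero    f = refl
  go (suc n) f with p (f F.zero)
  ... | true  = cong suc (go n (f ∘ F.suc))
  ... | false = go n (f ∘ F.suc)

count-cong : ∀ N {p q : Fin N → Bool} → (∀ x → p x ≡ q x) → count N p ≡ count N q
count-cong N {p} {q} p≗q = begin
  count N p                     ≡⟨ count≡∑ N p ⟩
  ∑[ x < N ] indicator (p x)    ≡⟨ sum-cong-≗ (cong indicator ∘ p≗q) ⟩
  ∑[ x < N ] indicator (q x)    ≡⟨ count≡∑ N q ⟨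
  count N q                     ∎
  where open ≡-Reasoning

∑-indicator-== : ∀ N (z : Fin N) → ∑[ x < N ] indicator (x == z) ≡ 1
∑-indicator-== (suc N) F.zero    = cong suc (sum-replicate-zero N)
∑-indicator-== (suc N) (F.suc z) = begin
  ∑[ x < N ] indicator (F.suc x == F.suc z)
    ≡⟨ sum-cong-≗ (λ x → cong indicator (⌊⌋-map′ (cong F.suc) F.suc-injective (x F.≟ z))) ⟩
  ∑[ x < N ] indicator (x == z)              ≡⟨ ∑-indicator-== N z ⟩
  1                                          ∎
  where open ≡-Reasoning

∑-indicator-∧-== : ∀ N (b : Bool) (z : Fin N) → ∑[ x < N ] indicator (b ∧ (x == z)) ≡ indicator b
∑-indicator-∧-== N false z = sum-replicate-zero N
∑-indicator-∧-== N true  z = ∑-indicator-== N z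

count-insert : ∀ N {p q : Fin N → Bool} (z : Fin N) →
  (∀ x → indicator (p x) ≡ indicator (q x) + indicator (x == z)) → count N p ≡ suc (count N q)
count-insert N {p} {q} z split = begin
  count N p                                                        ≡⟨ count≡∑ N p ⟩
  ∑[ x < N ] indicator (p x)                                       ≡⟨ sum-cong-≗ split ⟩
  ∑[ x < N ] (indicator (q x) + indicator (x == z))                ≡⟨ ∑-distrib-+ (indicator ∘ q) (λ x → indicator (x == z)) ⟩
  ∑[ x < N ] indicator (q x) + ∑[ x < N ] indicator (x == z)       ≡⟨ cong₂ _+_ (sym (count≡∑ N q)) (∑-indicator-== N z) ⟩
  count N q + 1                                                    ≡⟨ ℕ.+-comm _ 1 ⟩
  suc (count N q)                                                  ∎
  where open ≡-Reasoning

count≡0⇒false : ∀ N (p : Fin N → Bool) → count N p ≡ 0 → ∀ x → p x ≡ false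
count≡0⇒false N p c≡0 = go N p (trans (sym (count≡∑ N p)) c≡0)
  where
  go : ∀ n (p : Fin n → Bool) → ∑[ x < n ] indicator (p x) ≡ 0 → ∀ x → p x ≡ false
  go (suc n) p s≡0 x with p F.zero in p₀
  go (suc n) p s≡0 F.zero    | false = p₀
  go (suc n) p s≡0 (F.suc x) | false = go n (p ∘ F.suc) s≡0 x

count≡suc⇒witness : ∀ N (p : Fin N → Bool) {k} → count N p ≡ suc k → ∃ λ x → p x ≡ true
count≡suc⇒witness N p c≡1+k = go N p (trans (sym (count≡∑ N p)) c≡1+k)
  where
  go : ∀ n (p : Fin n → Bool) {k} → ∑[ x < n ] indicator (p x) ≡ suc k → ∃ λ x → p x ≡ true
  go (suc n) p s≡1+k with p F.zero in p₀
  ... | true  = F.zero , p₀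
  ... | false = let (x , px) = go n (p ∘ F.suc) s≡1+k in F.suc x , px

-- Double counting the pairs (x , φ x) with P x.
count-bijection : ∀ M L (P : Fin M → Bool) (Q : Fin L → Bool) (φ : Fin M → Fin L) (ψ : Fin L → Fin M) →
  (∀ x → P x ≡ true → Q (φ x) ≡ true) → (∀ u → Q u ≡ true → P (ψ u) ≡ true) →
  (∀ x → P x ≡ true → ψ (φ x) ≡ x) → (∀ u → Q u ≡ true → φ (ψ u) ≡ u) →
  count M P ≡ count L Q
count-bijection M L P Q φ ψ PQ QP ψφ φψ = begin
  count M P                                              ≡⟨ count≡∑ M P ⟩
  ∑[ x < M ] indicator (P x)                             ≡⟨ sum-cong-≗ (λ x → ∑-indicator-∧-== L (P x) (φ x)) ⟨
  ∑[ x < M ] ∑[ u < L ] indicator (P x ∧ (u == φ x))     ≡⟨ ∑-comm (λ x u → indicator (P x ∧ (u == φ x))) ⟩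
  ∑[ u < L ] ∑[ x < M ] indicator (P x ∧ (u == φ x))     ≡⟨ sum-cong-≗ (λ u → sum-cong-≗ (cong indicator ∘ graph-flip u)) ⟩
  ∑[ u < L ] ∑[ x < M ] indicator (Q u ∧ (x == ψ u))     ≡⟨ sum-cong-≗ (λ u → ∑-indicator-∧-== M (Q u) (ψ u)) ⟩
  ∑[ u < L ] indicator (Q u)                             ≡⟨ count≡∑ L Q ⟨
  count L Q                                              ∎
  where
  open ≡-Reasoning
  graph-flip : ∀ u x → (P x ∧ (u == φ x)) ≡ (Q u ∧ (x == ψ u))
  graph-flip u x = bool-ext
    (λ e → let u≡φx = ==⇒≡ (∧-conicalʳ _ _ e) in
      cong₂ _∧_ (subst (λ w → Q w ≡ true) (sym u≡φx) (PQ x (∧-conicalˡ _ _ e)))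
                (≡⇒== (trans (sym (ψφ x (∧-conicalˡ _ _ e))) (cong ψ (sym u≡φx)))))
    (λ e → let x≡ψu = ==⇒≡ (∧-conicalʳ _ _ e) in
      cong₂ _∧_ (subst (λ w → P w ≡ true) (sym x≡ψu) (QP u (∧-conicalˡ _ _ e)))
                (≡⇒== (trans (sym (φψ u (∧-conicalˡ _ _ e))) (cong φ (sym x≡ψu)))))

iter-+ : ∀ {A : Set} (f : A → A) a b x → iter (a + b) f x ≡ iter a f (iter b f x)
iter-+ f zero    b x = refl
iter-+ f (suc a) b x = cong f (iter-+ f a b x)

iter-*-fixed : ∀ {A : Set} (f : A → A) {x} t → iter t f x ≡ x → ∀ k → iter (k ℕ.* t) f x ≡ x
iter-*-fixed f     t fix zero    = refl
iter-*-fixed f {x} t fix (suc k) = begin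
  iter (t + k ℕ.* t) f x         ≡⟨ iter-+ f t (k ℕ.* t) x ⟩
  iter t f (iter (k ℕ.* t) f x)  ≡⟨ cong (iter t f) (iter-*-fixed f t fix k) ⟩
  iter t f x                   ≡⟨ fix ⟩
  x                            ∎
  where open ≡-Reasoning

iter-cong : ∀ {A : Set} {f g : A → A} → (∀ x → f x ≡ g x) → ∀ k x → iter k f x ≡ iter k g x
iter-cong f≗g zero    x = refl
iter-cong {g = g} f≗g (suc k) x = trans (f≗g _) (cong g (iter-cong f≗g k x))

iter-commute : ∀ {A : Set} (f : A → A) k x → iter k f (f x) ≡ f (iter k f x)
iter-commute f zero    x = refl
iter-commute f (suc k) x = cong f (iter-commute f k x)

iter-inverse : ∀ {A : Set} {f g : A → A} → (∀ x → f (g x) ≡ x) → ∀ k x → iter k f (iter k g x) ≡ x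
iter-inverse f∘g zero    x = refl
iter-inverse {f = f} {g} f∘g (suc k) x = begin
  f (iter k f (g (iter k g x)))  ≡⟨ iter-commute f k _ ⟨
  iter k f (f (g (iter k g x)))  ≡⟨ cong (iter k f) (f∘g _) ⟩
  iter k f (iter k g x)          ≡⟨ iter-inverse f∘g k x ⟩
  x                              ∎
  where open ≡-Reasoning

least : ∀ {n} {P : Fin n → Set} → Decidable P → ∀ z → P z →
  Σ (Fin n) λ w → P w × (∀ v → P v → toℕ w ≤ toℕ v)
least {suc n} P? z Pz with P? F.zero
... | yes P₀ = F.zero , P₀ , λ _ _ → z≤n
least {suc n} P? F.zero    Pz | no ¬P₀ = contradiction Pz ¬P₀
least {suc n} P? (F.suc z) Pz | no ¬P₀ =
  let (w , Pw , w≤) = least (P? ∘ F.suc) z Pz in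
  F.suc w , Pw , λ { F.zero P₀ → contradiction P₀ ¬P₀ ; (F.suc v) Pv → s≤s (w≤ v Pv) }

-- Classes of an equivalence relation, counted by their least elements

module _ {N : ℕ} (R : Rel (Fin N) 0ℓ) where

  IsLeast : Fin N → Set
  IsLeast x = ∀ y → R x y → toℕ x ≤ toℕ y

  MarksLeast : (Fin N → Bool) → Set
  MarksLeast P = ∀ x → P x ≡ true ⇔ IsLeast x


module Classes {N : ℕ} {R : Rel (Fin N) 0ℓ} (isDecEq : IsDecEquivalence R) where
  open IsDecEquivalence isDecEq public using (_≟_) renaming (refl to R-refl; sym to R-sym; trans to R-trans)

  private
    minimum : ∀ a → Σ (Fin N) λ w → R a w × (∀ v → R a v → toℕ w ≤ toℕ v)
    minimum a = least (a ≟_) a R-refl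

  classMin : Fin N → Fin N
  classMin a = proj₁ (minimum a)

  classMin-rel : ∀ a → R a (classMin a)
  classMin-rel a = proj₁ (proj₂ (minimum a))

  classMin-≤ : ∀ a y → R a y → toℕ (classMin a) ≤ toℕ y
  classMin-≤ a = proj₂ (proj₂ (minimum a))

  classMin-isLeast : ∀ a → IsLeast R (classMin a)
  classMin-isLeast a y r = classMin-≤ a y (R-trans (classMin-rel a) r)

  isLeast-unique : ∀ {x y} → R x y → IsLeast R x → IsLeast R y → x ≡ y
  isLeast-unique {x} {y} r lx ly = F.toℕ-injective (ℕ.≤-antisym (lx y r) (ly x (R-sym r)))

  isLeast⇒classMin : ∀ {a x} → R a x → IsLeast R x → x ≡ classMin a
  isLeast⇒classMin r lx = isLeast-unique (R-trans (R-sym r) (classMin-rel _)) lx (classMin-isLeast _)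

marks⇒true : ∀ {N} {R : Rel (Fin N) 0ℓ} {P x} → MarksLeast R P → IsLeast R x → P x ≡ true
marks⇒true marks = Equivalence.from (marks _)

marks⇒false : ∀ {N} {R : Rel (Fin N) 0ℓ} {P x} → MarksLeast R P → ¬ IsLeast R x → P x ≡ false
marks⇒false marks ¬least = ≢true⇒≡false (¬least ∘ Equivalence.to (marks _))

marks⇒isLeast : ∀ {N} {R : Rel (Fin N) 0ℓ} {P x} → MarksLeast R P → P x ≡ true → IsLeast R x
marks⇒isLeast marks = Equivalence.to (marks _)

pullback-isDecEquivalence : ∀ {N L} {R : Rel (Fin L) 0ℓ} → IsDecEquivalence R →
  (f : Fin N → Fin L) → IsDecEquivalence (λ x y → R (f x) (f y))
pullback-isDecEquivalence isDecEq f = record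
  { isEquivalence = record { refl = R-refl ; sym = R-sym ; trans = R-trans }
  ; _≟_ = λ x y → f x ≟ f y
  }
  where open IsDecEquivalence isDecEq renaming (refl to R-refl; sym to R-sym; trans to R-trans)

count-classes-pullback : ∀ {N L} {R : Rel (Fin L) 0ℓ} → IsDecEquivalence R →
  (f : Fin N → Fin L) (g : Fin L → Fin N) → (∀ u → f (g u) ≡ u) →
  {P : Fin N → Bool} {Q : Fin L → Bool} →
  MarksLeast (λ x y → R (f x) (f y)) P → MarksLeast R Q → count N P ≡ count L Q
count-classes-pullback {N} {L} {R} isDecEq f g f∘g {P} {Q} marksP marksQ =
  count-bijection N L P Q (R.classMin ∘ f) (R∘f.classMin ∘ g)
    (λ x _ → marks⇒true marksQ (R.classMin-isLeast (f x)))
    (λ u _ → marks⇒true marksP (R∘f.classMin-isLeast (g u)))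
    (λ x Px → sym (R∘f.isLeast⇒classMin (subst (λ v → R v (f x)) (sym (f∘g _)) (R.R-sym (R.classMin-rel (f x))))
                                         (marks⇒isLeast marksP Px)))
    (λ u Qu → sym (R.isLeast⇒classMin (subst (R _) (f∘g u) (R.R-sym (R∘f.classMin-rel (g u))))
                                       (marks⇒isLeast marksQ Qu)))
  where
  module R = Classes isDecEq
  module R∘f = Classes (pullback-isDecEquivalence isDecEq f)

-- Merging two classes A, B of R (with least elements lo < hi) into one class of R'
-- removes exactly one least element, namely hi.
module Merge {N : ℕ} {R R' : Rel (Fin N) 0ℓ} (isDecEq : IsDecEquivalence R) (a b : Fin N)
  (merged : ∀ x y → R' x y ⇔ (R x y ⊎ ((R a x ⊎ R b x) × (R a y ⊎ R b y))))
  {P P' : Fin N → Bool} (marksP : MarksLeast R P) (marksP' : MarksLeast R' P') where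
  open Classes isDecEq

  InAB : Fin N → Set
  InAB z = R a z ⊎ R b z

  R⇒R' : ∀ {x y} → R x y → R' x y
  R⇒R' r = Equivalence.from (merged _ _) (inj₁ r)

  isLeast'⇒isLeast : ∀ {x} → IsLeast R' x → IsLeast R x
  isLeast'⇒isLeast l' y r = l' y (R⇒R' r)

  isLeast⇒isLeast' : ∀ {x} → ¬ InAB x → IsLeast R x → IsLeast R' x
  isLeast⇒isLeast' ¬x∈AB l y r' with Equivalence.to (merged _ _) r'
  ... | inj₁ r          = l y r
  ... | inj₂ (x∈AB , _) = contradiction x∈AB ¬x∈AB

  module Ordered (lo<hi : toℕ (classMin a) < toℕ (classMin b)) where
    lo hi : Fin N
    lo = classMin a
    hi = classMin b

    lo≢hi : lo ≢ hi
    lo≢hi e = ℕ.<-irrefl (cong toℕ e) lo<hi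

    lo-isLeast' : IsLeast R' lo
    lo-isLeast' y r' with Equivalence.to (merged _ _) r'
    ... | inj₁ r            = classMin-isLeast a y r
    ... | inj₂ (_ , inj₁ r) = classMin-≤ a y r
    ... | inj₂ (_ , inj₂ r) = ℕ.<⇒≤ (ℕ.<-≤-trans lo<hi (classMin-≤ b y r))

    hi-¬isLeast' : ¬ IsLeast R' hi
    hi-¬isLeast' l' = ℕ.<⇒≱ lo<hi (l' lo (Equivalence.from (merged _ _)
                        (inj₂ (inj₂ (classMin-rel b) , inj₁ (classMin-rel a)))))

    isLeast-in-AB : ∀ {x} → InAB x → IsLeast R x → x ≡ lo ⊎ x ≡ hi
    isLeast-in-AB (inj₁ r) l = inj₁ (isLeast⇒classMin r l)
    isLeast-in-AB (inj₂ r) l = inj₂ (isLeast⇒classMin r l)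

    indicator-split : ∀ x → indicator (P x) ≡ indicator (P' x) + indicator (x == hi)
    indicator-split x with x F.≟ lo
    ... | yes refl rewrite marks⇒true marksP (classMin-isLeast a) | marks⇒true marksP' lo-isLeast'
                         | ≢⇒==false lo≢hi = refl
    ... | no x≢lo with x F.≟ hi
    ...   | yes refl rewrite marks⇒true marksP (classMin-isLeast b) | marks⇒false marksP' hi-¬isLeast' = refl
    ...   | no x≢hi = trans (cong indicator P≡P') (sym (ℕ.+-identityʳ _))
      where
      outside : IsLeast R x → ¬ InAB x
      outside l x∈AB = [ x≢lo , x≢hi ]′ (isLeast-in-AB x∈AB l)
      P≡P' : P x ≡ P' x
      P≡P' = bool-ext (λ Px → let l = marks⇒isLeast marksP Px in marks⇒true marksP' (isLeast⇒isLeast' (outside l) l))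
                      (λ P'x → marks⇒true marksP (isLeast'⇒isLeast (marks⇒isLeast marksP' P'x)))

    count-ordered : count N P ≡ suc (count N P')
    count-ordered = count-insert N hi indicator-split

count-classes-merge : ∀ {N} {R R' : Rel (Fin N) 0ℓ} → IsDecEquivalence R → (a b : Fin N) → ¬ R a b →
  (∀ x y → R' x y ⇔ (R x y ⊎ ((R a x ⊎ R b x) × (R a y ⊎ R b y)))) →
  {P P' : Fin N → Bool} → MarksLeast R P → MarksLeast R' P' → count N P ≡ suc (count N P')
count-classes-merge {N} {R} {R'} isDecEq a b ¬ab merged marksP marksP' =
  by-order (ℕ.<-cmp (toℕ (classMin a)) (toℕ (classMin b)))
  where
  open Classes isDecEq
  merged-ba : ∀ x y → R' x y ⇔ (R x y ⊎ ((R b x ⊎ R a x) × (R b y ⊎ R a y)))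
  merged-ba x y = mk⇔ (Sum.map₂ (Product.map Sum.swap Sum.swap) ∘ Equivalence.to (merged x y))
                      (Equivalence.from (merged x y) ∘ Sum.map₂ (Product.map Sum.swap Sum.swap))
  by-order : Tri _ _ _ → count N _ ≡ suc (count N _)
  by-order (tri< lt _ _) = Merge.Ordered.count-ordered isDecEq a b merged marksP marksP' lt
  by-order (tri> _ _ gt) = Merge.Ordered.count-ordered isDecEq b a merged-ba marksP marksP' gt
  by-order (tri≈ _ eq _) = contradiction
    (R-trans (classMin-rel a) (subst (λ v → R v b) (sym (F.toℕ-injective eq)) (R-sym (classMin-rel b)))) ¬ab

count-marksLeast-unique : ∀ {N} {R R' : Rel (Fin N) 0ℓ} → (∀ x y → R x y ⇔ R' x y) →
  {P P' : Fin N → Bool} → MarksLeast R P → MarksLeast R' P' → count N P ≡ count N P'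
count-marksLeast-unique R⇔R' marksP marksP' = count-cong _ λ x → bool-ext
  (λ Px → marks⇒true marksP' λ y r' → marks⇒isLeast marksP Px y (Equivalence.from (R⇔R' x y) r'))
  (λ P'x → marks⇒true marksP λ y r → marks⇒isLeast marksP' P'x y (Equivalence.to (R⇔R' x y) r))

-- Cycles of a permutation

module Orbits {M : ℕ} (p p⁻¹ : Fin M → Fin M)
  (p∘p⁻¹ : ∀ x → p (p⁻¹ x) ≡ x) (p⁻¹∘p : ∀ x → p⁻¹ (p x) ≡ x) where

  infix 4 _~_
  _~_ : Rel (Fin M) 0ℓ
  x ~ y = ∃ λ k → iter k p x ≡ y

  iter-injective : ∀ k {x y} → iter k p x ≡ iter k p y → x ≡ y
  iter-injective zero    e = e
  iter-injective (suc k) e = iter-injective k (trans (sym (p⁻¹∘p _)) (trans (cong p⁻¹ e) (p⁻¹∘p _)))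

  period : ∀ x → ∃ λ t → 1 ≤ t × t ≤ M × iter t p x ≡ x
  period x with F.pigeonhole (ℕ.n<1+n M) (λ (i : Fin (suc M)) → iter (toℕ i) p x)
  ... | i , j , i<j , pⁱx≡pʲx =
    toℕ j ∸ toℕ i , ℕ.m<n⇒0<n∸m i<j , ℕ.≤-trans (ℕ.m∸n≤m (toℕ j) (toℕ i)) (ℕ.<⇒≤pred (F.toℕ<n j)) ,
    sym (iter-injective (toℕ i) (trans pⁱx≡pʲx (begin
      iter (toℕ j) p x                                ≡⟨ cong (λ k → iter k p x) (ℕ.m+[n∸m]≡n (ℕ.<⇒≤ i<j)) ⟨
      iter (toℕ i + (toℕ j ∸ toℕ i)) p x              ≡⟨ iter-+ p (toℕ i) _ x ⟩
      iter (toℕ i) p (iter (toℕ j ∸ toℕ i) p x)       ∎)))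
    where open ≡-Reasoning

  ~-refl : ∀ {x} → x ~ x
  ~-refl = 0 , refl

  ~-step : ∀ x → x ~ p x
  ~-step x = 1 , refl

  ~-trans : ∀ {x y z} → x ~ y → y ~ z → x ~ z
  ~-trans (k , refl) (j , refl) = j + k , iter-+ p j k _

  ~-sym : ∀ {x y} → x ~ y → y ~ x
  ~-sym {x} (k , refl) with period x
  ... | suc t , _ , _ , fixed = k ℕ.* t , (begin
    iter (k ℕ.* t) p (iter k p x)    ≡⟨ iter-+ p (k ℕ.* t) k x ⟨
    iter (k ℕ.* t + k) p x           ≡⟨ cong (λ n → iter n p x) (trans (ℕ.+-comm (k ℕ.* t) k) (sym (ℕ.*-suc k t))) ⟩
    iter (k ℕ.* suc t) p x           ≡⟨ iter-*-fixed p (suc t) fixed k ⟩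
    x                              ∎)
    where open ≡-Reasoning

  ~-bounded : ∀ {x y} → x ~ y → ∃ λ k → k < M × iter k p x ≡ y
  ~-bounded {x} (k , refl) with period x
  ... | suc t , _ , t<M , fixed = k % suc t , ℕ.<-≤-trans (m%n<n k (suc t)) t<M , (begin
    iter (k % suc t) p x                                  ≡⟨ cong (iter (k % suc t) p) (iter-*-fixed p (suc t) fixed (k / suc t)) ⟨
    iter (k % suc t) p (iter (k / suc t ℕ.* suc t) p x)     ≡⟨ iter-+ p (k % suc t) _ x ⟨
    iter (k % suc t + k / suc t ℕ.* suc t) p x              ≡⟨ cong (λ n → iter n p x) (m≡m%n+[m/n]*n k (suc t)) ⟨
    iter k p x                                            ∎)
    where open ≡-Reasoning

  ~-positive : ∀ {x y} → x ~ y → ∃ λ k → iter (suc k) p x ≡ y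
  ~-positive {x} (k , refl) with period x
  ... | suc t , _ , _ , fixed = k + t , (begin
    iter (suc (k + t)) p x          ≡⟨ cong (λ n → iter n p x) (ℕ.+-suc k t) ⟨
    iter (k + suc t) p x            ≡⟨ iter-+ p k (suc t) x ⟩
    iter k p (iter (suc t) p x)     ≡⟨ cong (iter k p) fixed ⟩
    iter k p x                      ∎)
    where open ≡-Reasoning

  _~?_ : ∀ x y → Dec (x ~ y)
  x ~? y with F.any? (λ (k : Fin M) → iter (toℕ k) p x F.≟ y)
  ... | yes (k , e) = yes (toℕ k , e)
  ... | no ¬any     = no λ x~y → let (k , k<M , e) = ~-bounded x~y in
                        ¬any (fromℕ< k<M , trans (cong (λ n → iter n p x) (F.toℕ-fromℕ< k<M)) e)

  ~-isDecEquivalence : IsDecEquivalence _~_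
  ~-isDecEquivalence = record
    { isEquivalence = record { refl = ~-refl ; sym = ~-sym ; trans = ~-trans }
    ; _≟_ = _~?_
    }

  first-visit : ∀ {x y} → x ~ y → ∃ λ j → iter j p x ≡ y × (∀ l → l < j → iter l p x ≢ y)
  first-visit {x} {y} x~y with ~-bounded x~y
  ... | k , k<M , e with least (λ (v : Fin M) → iter (toℕ v) p x F.≟ y) (fromℕ< k<M)
                                (trans (cong (λ n → iter n p x) (F.toℕ-fromℕ< k<M)) e)
  ... | w , pʷx≡y , w-least = toℕ w , pʷx≡y , λ l l<w pˡx≡y →
    let l<M = ℕ.<-trans l<w (F.toℕ<n w) in
    ℕ.<⇒≱ l<w (subst (toℕ w ≤_) (F.toℕ-fromℕ< l<M)
      (w-least (fromℕ< l<M) (trans (cong (λ n → iter n p x) (F.toℕ-fromℕ< l<M)) pˡx≡y)))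

  orbits-marksLeast : MarksLeast _~_ (λ x → all (λ k → toℕ x ≤ᵇ toℕ (iter k p x)) (upTo M))
  orbits-marksLeast x = mk⇔
    (λ e y x~y → let (k , k<M , pᵏx≡y) = ~-bounded x~y in
       subst (λ v → toℕ x ≤ toℕ v) pᵏx≡y (≤ᵇ⇒≤ (Equivalence.to (all-upTo M _) e k k<M)))
    (λ l → Equivalence.from (all-upTo M _) λ k _ → ≤⇒≤ᵇ (l _ (k , refl)))

transpose-matchˡ : ∀ {n} (i j : Fin n) → transpose i j i ≡ j
transpose-matchˡ i j rewrite dec-true (i F.≟ i) refl = refl

transpose-matchʳ : ∀ {n} (i j : Fin n) → transpose i j j ≡ i
transpose-matchʳ i j with j F.≟ i
... | yes j≡i = j≡i
... | no  _   rewrite dec-true (j F.≟ j) refl = refl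

transpose-other : ∀ {n} {i j k : Fin n} → k ≢ i → k ≢ j → transpose i j k ≡ k
transpose-other {i = i} {j} {k} k≢i k≢j rewrite dec-false (k F.≟ i) k≢i | dec-false (k F.≟ j) k≢j = refl

transpose-involutive : ∀ {n} (i j k : Fin n) → transpose i j (transpose i j k) ≡ k
transpose-involutive i j k = by-cases (k F.≟ i) (k F.≟ j)
  where
  by-cases : Dec (k ≡ i) → Dec (k ≡ j) → transpose i j (transpose i j k) ≡ k
  by-cases (yes k≡i) _ = subst (λ v → transpose i j (transpose i j v) ≡ v) (sym k≡i)
    (trans (cong (transpose i j) (transpose-matchˡ i j)) (transpose-matchʳ i j))
  by-cases (no _) (yes k≡j) = subst (λ v → transpose i j (transpose i j v) ≡ v) (sym k≡j)
    (trans (cong (transpose i j) (transpose-matchʳ i j)) (transpose-matchˡ i j))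
  by-cases (no k≢i) (no k≢j) = trans (cong (transpose i j) (transpose-other k≢i k≢j)) (transpose-other k≢i k≢j)

module Transposition {M : ℕ} (p p⁻¹ : Fin M → Fin M)
  (p∘p⁻¹ : ∀ x → p (p⁻¹ x) ≡ x) (p⁻¹∘p : ∀ x → p⁻¹ (p x) ≡ x)
  (a b : Fin M) (a≢b : a ≢ b) (p' : Fin M → Fin M) (p'≗ : ∀ x → p' x ≡ p (transpose a b x)) where

  p'⁻¹ : Fin M → Fin M
  p'⁻¹ x = transpose a b (p⁻¹ x)

  p'∘p'⁻¹ : ∀ x → p' (p'⁻¹ x) ≡ x
  p'∘p'⁻¹ x = trans (p'≗ _) (trans (cong p (transpose-involutive a b _)) (p∘p⁻¹ x))

  p'⁻¹∘p' : ∀ x → p'⁻¹ (p' x) ≡ x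
  p'⁻¹∘p' x = trans (cong (transpose a b ∘ p⁻¹) (p'≗ x))
                    (trans (cong (transpose a b) (p⁻¹∘p _)) (transpose-involutive a b x))

  open Orbits p p⁻¹ p∘p⁻¹ p⁻¹∘p
  open Orbits p' p'⁻¹ p'∘p'⁻¹ p'⁻¹∘p' using () renaming
    (_~_ to _~'_; ~-sym to ~'-sym; ~-trans to ~'-trans; orbits-marksLeast to orbits'-marksLeast)

  p'-a : p' a ≡ p b
  p'-a = trans (p'≗ a) (cong p (transpose-matchˡ a b))

  p'-b : p' b ≡ p a
  p'-b = trans (p'≗ b) (cong p (transpose-matchʳ a b))

  p'-other : ∀ {x} → x ≢ a → x ≢ b → p' x ≡ p x
  p'-other x≢a x≢b = trans (p'≗ _) (cong p (transpose-other x≢a x≢b))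

  iter-agree : ∀ L y → (∀ j → j < L → iter j p y ≢ a × iter j p y ≢ b) → iter L p' y ≡ iter L p y
  iter-agree zero    y avoids = refl
  iter-agree (suc L) y avoids =
    let (≢a , ≢b) = avoids L (ℕ.n<1+n L) in
    trans (cong p' (iter-agree L y (λ j j<L → avoids j (ℕ.m<n⇒m<1+n j<L)))) (p'-other ≢a ≢b)

  -- A p-path that reaches c before ever meeting {a, b} \ {c} is also a p'-path.
  ~⇒~'-avoiding : ∀ {z c o} → z ~ c → ¬ z ~ o → (∀ w → w ≢ c → w ≢ o → w ≢ a × w ≢ b) → z ~' c
  ~⇒~'-avoiding {z} z~c ¬z~o outside with first-visit z~c
  ... | j , pʲz≡c , before = j , trans (iter-agree j z λ l l<j → outside _ (before l l<j) (λ e → ¬z~o (l , e))) pʲz≡c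

  module Joined (¬a~b : ¬ a ~ b) where
    InAB : Fin M → Set
    InAB z = a ~ z ⊎ b ~ z

    InAB-closed : ∀ {z} → InAB z → InAB (p' z)
    InAB-closed {z} z∈AB with z F.≟ a | z F.≟ b
    ... | yes refl | _        = inj₂ (subst (b ~_) (sym p'-a) (~-step b))
    ... | no _     | yes refl = inj₁ (subst (a ~_) (sym p'-b) (~-step a))
    ... | no z≢a   | no z≢b   = Sum.map (λ r → ~-trans r (subst (z ~_) (sym (p'-other z≢a z≢b)) (~-step z)))
                                        (λ r → ~-trans r (subst (z ~_) (sym (p'-other z≢a z≢b)) (~-step z))) z∈AB

    iter-InAB : ∀ {z} → InAB z → ∀ k → InAB (iter k p' z)
    iter-InAB z∈AB zero    = z∈AB
    iter-InAB z∈AB (suc k) = InAB-closed (iter-InAB z∈AB k)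

    avoids : ∀ {x} → ¬ InAB x → ∀ j → iter j p x ≢ a × iter j p x ≢ b
    avoids ¬x∈AB j = (λ e → ¬x∈AB (inj₁ (~-sym (j , e)))) , (λ e → ¬x∈AB (inj₂ (~-sym (j , e))))

    class-a⇒~'a : ∀ {z} → a ~ z → z ~' a
    class-a⇒~'a a~z = ~⇒~'-avoiding (~-sym a~z) (λ z~b → ¬a~b (~-trans a~z z~b)) (λ _ w≢a w≢b → w≢a , w≢b)

    class-b⇒~'b : ∀ {z} → b ~ z → z ~' b
    class-b⇒~'b b~z = ~⇒~'-avoiding (~-sym b~z) (λ z~a → ¬a~b (~-sym (~-trans b~z z~a))) (λ _ w≢b w≢a → w≢a , w≢b)

    InAB⇒~'a : ∀ {z} → InAB z → z ~' a
    InAB⇒~'a (inj₁ a~z) = class-a⇒~'a a~z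
    InAB⇒~'a (inj₂ b~z) = ~'-trans (class-b⇒~'b b~z) (~'-trans (1 , p'-b) (class-a⇒~'a (~-step a)))

    InAB? : ∀ z → InAB z ⊎ ¬ InAB z
    InAB? z with a ~? z | b ~? z
    ... | yes a~z | _       = inj₁ (inj₁ a~z)
    ... | no _    | yes b~z = inj₁ (inj₂ b~z)
    ... | no ¬a~z | no ¬b~z = inj₂ [ ¬a~z , ¬b~z ]′

    merged : ∀ x y → x ~' y ⇔ (x ~ y ⊎ (InAB x × InAB y))
    merged x y = mk⇔ to from
      where
      to : x ~' y → x ~ y ⊎ (InAB x × InAB y)
      to (k , p'ᵏx≡y) with InAB? x
      ... | inj₁ x∈AB  = inj₂ (x∈AB , subst InAB p'ᵏx≡y (iter-InAB x∈AB k))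
      ... | inj₂ ¬x∈AB = inj₁ (k , trans (sym (iter-agree k x (λ j _ → avoids ¬x∈AB j))) p'ᵏx≡y)
      from : x ~ y ⊎ (InAB x × InAB y) → x ~' y
      from (inj₂ (x∈AB , y∈AB)) = ~'-trans (InAB⇒~'a x∈AB) (~'-sym (InAB⇒~'a y∈AB))
      from (inj₁ (k , pᵏx≡y)) with InAB? x
      ... | inj₁ x∈AB  = from (inj₂ (x∈AB , Sum.map (λ r → ~-trans r (k , pᵏx≡y))
                                                    (λ r → ~-trans r (k , pᵏx≡y)) x∈AB))
      ... | inj₂ ¬x∈AB = k , trans (iter-agree k x (λ j _ → avoids ¬x∈AB j)) pᵏx≡y

    orbits-joined : orbits M p ≡ suc (orbits M p')
    orbits-joined = count-classes-merge ~-isDecEquivalence a b ¬a~b merged orbits-marksLeast orbits'-marksLeast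

  -- If a lies on the cycle of b, that cycle a → … → b → … splits: p' maps the
  -- arc {p a, …, b} to itself, so it never returns to a.
  module Split (a~b : a ~ b) where
    k : ℕ
    k = proj₁ (first-visit a~b)

    pᵏa≡b : iter k p a ≡ b
    pᵏa≡b = proj₁ (proj₂ (first-visit a~b))

    before-b : ∀ l → l < k → iter l p a ≢ b
    before-b = proj₂ (proj₂ (first-visit a~b))

    1≤k : 1 ≤ k
    1≤k with k in k≡
    ... | zero  = contradiction (trans (cong (λ n → iter n p a) (sym k≡)) pᵏa≡b) a≢b
    ... | suc _ = s≤s z≤n

    no-return : ∀ i → 1 ≤ i → i ≤ k → iter i p a ≢ a
    no-return i 1≤i i≤k pⁱa≡a = before-b (k ∸ i) (ℕ.∸-monoʳ-< 1≤i i≤k) (begin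
      iter (k ∸ i) p a               ≡⟨ cong (iter (k ∸ i) p) pⁱa≡a ⟨
      iter (k ∸ i) p (iter i p a)    ≡⟨ iter-+ p (k ∸ i) i a ⟨
      iter (k ∸ i + i) p a           ≡⟨ cong (λ n → iter n p a) (ℕ.m∸n+n≡m i≤k) ⟩
      iter k p a                     ≡⟨ pᵏa≡b ⟩
      b                              ∎)
      where open ≡-Reasoning

    OnArc : Fin M → Set
    OnArc y = ∃ λ i → 1 ≤ i × i ≤ k × iter i p a ≡ y

    OnArc-closed : ∀ {y} → OnArc y → OnArc (p' y)
    OnArc-closed (i , 1≤i , i≤k , refl) with ℕ.m≤n⇒m<n∨m≡n i≤k
    ... | inj₂ refl = 1 , s≤s z≤n , 1≤k , sym (trans (cong p' pᵏa≡b) p'-b)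
    ... | inj₁ i<k  = suc i , s≤s z≤n , i<k , sym (p'-other (no-return i 1≤i i≤k) (before-b i i<k))

    ¬a~'b : ¬ a ~' b
    ¬a~'b a~'b with ~'-sym a~'b
    ... | j , p'ʲb≡a with iterate j
      where
      iterate : ∀ j → OnArc (iter j p' b)
      iterate zero    = k , 1≤k , ℕ.≤-refl , pᵏa≡b
      iterate (suc j) = OnArc-closed (iterate j)
    ... | i , 1≤i , i≤k , pⁱa≡p'ʲb = no-return i 1≤i i≤k (trans pⁱa≡p'ʲb p'ʲb≡a)

orbits-transpose : ∀ {M} (p p⁻¹ : Fin M → Fin M) → (∀ x → p (p⁻¹ x) ≡ x) → (∀ x → p⁻¹ (p x) ≡ x) →
  (a b : Fin M) → a ≢ b → (p' : Fin M → Fin M) → (∀ x → p' x ≡ p (transpose a b x)) →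
  orbits M p ≡ suc (orbits M p') ⊎ orbits M p' ≡ suc (orbits M p)
orbits-transpose p p⁻¹ p∘p⁻¹ p⁻¹∘p a b a≢b p' p'≗ with Orbits._~?_ p p⁻¹ p∘p⁻¹ p⁻¹∘p a b
... | no ¬a~b = inj₁ (T.Joined.orbits-joined ¬a~b)
  where module T = Transposition p p⁻¹ p∘p⁻¹ p⁻¹∘p a b a≢b p' p'≗
... | yes a~b = inj₂ (T'.Joined.orbits-joined (T.Split.¬a~'b a~b))
  where
  module T = Transposition p p⁻¹ p∘p⁻¹ p⁻¹∘p a b a≢b p' p'≗
  p≗ : ∀ x → p x ≡ p' (transpose a b x)
  p≗ x = sym (trans (p'≗ _) (cong p (transpose-involutive a b x)))
  module T' = Transposition p' T.p'⁻¹ T.p'∘p'⁻¹ T.p'⁻¹∘p' a b a≢b p p≗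

orbits-cong : ∀ M {p p' : Fin M → Fin M} → (∀ x → p x ≡ p' x) → orbits M p ≡ orbits M p'
orbits-cong M p≗p' = count-cong M λ x →
  all-cong (λ k → cong (λ y → toℕ x ≤ᵇ toℕ y) (iter-cong p≗p' k x)) (upTo M)

curves-cong : ∀ N (μ : Fin N → Fin N) {τ τ' : Fin N → Fin N} → (∀ x → τ x ≡ τ' x) → curves N μ τ ≡ curves N μ τ'
curves-cong N μ {τ} {τ'} τ≗τ' = count-cong N λ x → all-cong (λ k →
  let πᵏx≡π'ᵏx = iter-cong (λ y → cong μ (τ≗τ' y)) k x in
  cong₂ _∧_ (cong (λ y → toℕ x ≤ᵇ toℕ y) πᵏx≡π'ᵏx)
            (cong (λ y → toℕ x ≤ᵇ toℕ y) (trans (τ≗τ' _) (cong τ' πᵏx≡π'ᵏx)))) (upTo N)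

module _ {A : Set} where

  sumℤ-cong : ∀ xs {f g : A → ℤ} → (∀ a → f a ≡ g a) → sumℤ xs f ≡ sumℤ xs g
  sumℤ-cong []       f≗g = refl
  sumℤ-cong (x ∷ xs) f≗g = cong₂ _+ℤ_ (f≗g x) (sumℤ-cong xs f≗g)

  sumℤ-zero : ∀ xs → sumℤ xs (λ (_ : A) → 0ℤ) ≡ 0ℤ
  sumℤ-zero []       = refl
  sumℤ-zero (x ∷ xs) = trans (ℤ.+-identityˡ _) (sumℤ-zero xs)

  sumℤ-+ : ∀ xs (f g : A → ℤ) → sumℤ xs (λ a → f a +ℤ g a) ≡ sumℤ xs f +ℤ sumℤ xs g
  sumℤ-+ []       f g = refl
  sumℤ-+ (x ∷ xs) f g = trans (cong ((f x +ℤ g x) +ℤ_) (sumℤ-+ xs f g)) (interchange (f x) (g x) _ _)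

  sumℤ-*ˡ : ∀ k xs (f : A → ℤ) → sumℤ xs (λ a → k * f a) ≡ k * sumℤ xs f
  sumℤ-*ˡ k []       f = sym (ℤ.*-zeroʳ k)
  sumℤ-*ˡ k (x ∷ xs) f = trans (cong (k * f x +ℤ_) (sumℤ-*ˡ k xs f)) (sym (ℤ.*-distribˡ-+ k (f x) _))

  sumℤ-++ : ∀ xs ys (f : A → ℤ) → sumℤ (xs ++ ys) f ≡ sumℤ xs f +ℤ sumℤ ys f
  sumℤ-++ []       ys f = sym (ℤ.+-identityˡ _)
  sumℤ-++ (x ∷ xs) ys f = trans (cong (f x +ℤ_) (sumℤ-++ xs ys f)) (sym (ℤ.+-assoc (f x) _ _))

sumℤ-swap : ∀ {A B : Set} xs ys (F : A → B → ℤ) →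
  sumℤ xs (λ a → sumℤ ys (F a)) ≡ sumℤ ys (λ b → sumℤ xs (λ a → F a b))
sumℤ-swap []       ys F = sym (sumℤ-zero ys)
sumℤ-swap (x ∷ xs) ys F = trans (cong (sumℤ ys (F x) +ℤ_) (sumℤ-swap xs ys F))
                                (sym (sumℤ-+ ys (F x) (λ b → sumℤ xs (λ a → F a b))))

sumℤ-concatMap : ∀ {A B : Set} (g : A → List B) xs (f : B → ℤ) →
  sumℤ (concatMap g xs) f ≡ sumℤ xs (λ a → sumℤ (g a) f)
sumℤ-concatMap g []       f = refl
sumℤ-concatMap g (x ∷ xs) f = trans (sumℤ-++ (g x) (concatMap g xs) f) (cong (sumℤ (g x) f +ℤ_) (sumℤ-concatMap g xs f))

sumℤ-map : ∀ {A B : Set} (g : A → B) xs (f : B → ℤ) → sumℤ (map g xs) f ≡ sumℤ xs (f ∘ g)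
sumℤ-map g []       f = refl
sumℤ-map g (x ∷ xs) f = cong (f (g x) +ℤ_) (sumℤ-map g xs f)

sumℤ-tabulate : ∀ {A : Set} n (g : Fin n → A) (f : A → ℤ) → sumℤ (tabulate g) f ≡ ℤΣ.sum (f ∘ g)
sumℤ-tabulate zero    g f = refl
sumℤ-tabulate (suc n) g f = cong (f (g F.zero) +ℤ_) (sumℤ-tabulate n (g ∘ F.suc) f)

-- vs lists every element of A exactly once.
Enumerates : {A : Set} → DecidableEquality A → List A → Set
Enumerates {A} _≟_ vs = ∀ a (h : A → ℤ) → sumℤ vs (λ v → if does (v ≟ a) then h v else 0ℤ) ≡ h a

bools-enumerate : Enumerates Bool._≟_ (false ∷ true ∷ [])
bools-enumerate false h = ℤ.+-identityʳ (h false)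
bools-enumerate true  h = trans (ℤ.+-identityˡ _) (ℤ.+-identityʳ (h true))

allFin-enumerates : ∀ N → Enumerates F._≟_ (allFin N)
allFin-enumerates N a h = trans (sumℤ-tabulate N id _) (∑-delta N a h)
  where
  ∑-delta : ∀ N (a : Fin N) (h : Fin N → ℤ) → ℤΣ.sum (λ v → if does (v F.≟ a) then h v else 0ℤ) ≡ h a
  ∑-delta (suc N) F.zero    h = trans (cong (h F.zero +ℤ_) (ℤΣ.sum-replicate-zero N)) (ℤ.+-identityʳ _)
  ∑-delta (suc N) (F.suc a) h = trans (ℤ.+-identityˡ _) (∑-delta N a (h ∘ F.suc))

module _ {A : Set} (_≟_ : DecidableEquality A) where

  _≗?_ : ∀ {n} (f g : Fin n → A) → Dec (∀ i → f i ≡ g i)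
  f ≗? g = F.all? (λ i → f i ≟ g i)

  ≗?-congˡ : ∀ {n} {f f' t : Fin n → A} → (∀ i → f i ≡ f' i) → does (f ≗? t) ≡ does (f' ≗? t)
  ≗?-congˡ {f = f} {f'} {t} f≗f' = does-≡ (f ≗? t)
    (map′ (λ f'≗t i → trans (f≗f' i) (f'≗t i)) (λ f≗t i → trans (sym (f≗f' i)) (f≗t i)) (f' ≗? t))

  private
    _◂_ : ∀ {n} → A → (Fin n → A) → Fin (suc n) → A
    (a ◂ f) F.zero    = a
    (a ◂ f) (F.suc i) = f i

  allFuns-enumerates : ∀ {vs} → Enumerates _≟_ vs → ∀ n (t : Fin n → A) (h : (Fin n → A) → ℤ) →
    (∀ f g → (∀ i → f i ≡ g i) → h f ≡ h g) →
    sumℤ (allFuns n vs) (λ f → if does (f ≗? t) then h f else 0ℤ) ≡ h t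
  allFuns-enumerates enum zero    t h h-cong = trans (ℤ.+-identityʳ _) (h-cong _ _ λ ())
  allFuns-enumerates {vs} enum (suc n) t h h-cong = begin
    sumℤ (allFuns (suc n) vs) G
      ≡⟨ sumℤ-concatMap _ (allFuns n vs) G ⟩
    sumℤ (allFuns n vs) (λ f → sumℤ (map _ vs) G)
      ≡⟨ sumℤ-cong (allFuns n vs) (λ f → trans (sumℤ-map _ vs G)
           (sumℤ-cong vs λ a → G-cong _ (a ◂ f) λ { F.zero → refl ; (F.suc i) → refl })) ⟩
    sumℤ (allFuns n vs) (λ f → sumℤ vs (λ a → G (a ◂ f)))
      ≡⟨ sumℤ-cong (allFuns n vs) first-value ⟩
    sumℤ (allFuns n vs) (λ f → if does (f ≗? (t ∘ F.suc)) then h (t F.zero ◂ f) else 0ℤ)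
      ≡⟨ allFuns-enumerates enum n (t ∘ F.suc) (λ f → h (t F.zero ◂ f))
           (λ f g f≗g → h-cong _ _ λ { F.zero → refl ; (F.suc i) → f≗g i }) ⟩
    h (t F.zero ◂ (t ∘ F.suc))
      ≡⟨ h-cong _ _ (λ { F.zero → refl ; (F.suc i) → refl }) ⟩
    h t
      ∎
    where
    open ≡-Reasoning
    G : (Fin (suc n) → A) → ℤ
    G f = if does (f ≗? t) then h f else 0ℤ
    G-cong : ∀ f g → (∀ i → f i ≡ g i) → G f ≡ G g
    G-cong f g f≗g = cong₂ (λ b v → if b then v else 0ℤ) (≗?-congˡ {t = t} f≗g) (h-cong f g f≗g)
    first-value : ∀ f → sumℤ vs (λ a → G (a ◂ f)) ≡ (if does (f ≗? (t ∘ F.suc)) then h (t F.zero ◂ f) else 0ℤ)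
    first-value f = trans (sumℤ-cong vs (λ a → if-∧ (does (a ≟ t F.zero))))
                          (enum (t F.zero) (λ a → if does (f ≗? (t ∘ F.suc)) then h (a ◂ f) else 0ℤ))

does⇒ : ∀ {X : Set} (d : Dec X) → does d ≡ true → X
does⇒ (yes x) _ = x

-- Reindexing a sum over the functions Fin k → B along an injection F whose image is Q.
module _ {A B : Set} {_≟A_ : DecidableEquality A} {_≟B_ : DecidableEquality B} {vsA vsB}
  (enumA : Enumerates _≟A_ vsA) (enumB : Enumerates _≟B_ vsB) {n k : ℕ}
  (P : (Fin n → A) → Bool) (Q : (Fin k → B) → Bool) (F : (Fin n → A) → Fin k → B) (g : (Fin k → B) → ℤ)
  (P-cong : ∀ s s' → (∀ i → s i ≡ s' i) → P s ≡ P s')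
  (Q-cong : ∀ t t' → (∀ i → t i ≡ t' i) → Q t ≡ Q t')
  (g-cong : ∀ t t' → (∀ i → t i ≡ t' i) → g t ≡ g t')
  (F-cong : ∀ s s' → (∀ i → s i ≡ s' i) → ∀ i → F s i ≡ F s' i)
  (F-injective : ∀ s s' → (∀ i → F s i ≡ F s' i) → ∀ i → s i ≡ s' i)
  (P⇒Q : ∀ s → P s ≡ true → Q (F s) ≡ true)
  (Q⇒P : ∀ t → Q t ≡ true → ∃ λ s → P s ≡ true × (∀ i → t i ≡ F s i)) where

  private
    term : (Fin n → A) → (Fin k → B) → ℤ
    term s t = if P s ∧ does (_≗?_ _≟B_ t (F s)) then g t else 0ℤ

    fibre : ∀ t → (if Q t then g t else 0ℤ) ≡ sumℤ (allFuns n vsA) (λ s → term s t)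
    fibre t with Q t in Qt
    ... | true  = let (s₀ , Ps₀ , t≗Fs₀) = Q⇒P t Qt in sym (trans
      (sumℤ-cong (allFuns n vsA) λ s → cong (λ b → if b then g t else 0ℤ) (in-fibre s₀ Ps₀ t≗Fs₀ s))
      (allFuns-enumerates _≟A_ enumA n s₀ (λ _ → g t) (λ _ _ _ → refl)))
      where
      in-fibre : ∀ s₀ → P s₀ ≡ true → (∀ i → t i ≡ F s₀ i) → ∀ s →
        (P s ∧ does (_≗?_ _≟B_ t (F s))) ≡ does (_≗?_ _≟A_ s s₀)
      in-fibre s₀ Ps₀ t≗Fs₀ s = bool-ext
        (λ e → let t≗Fs = does⇒ (_≗?_ _≟B_ t (F s)) (∧-conicalʳ _ _ e) in
          dec-true (_≗?_ _≟A_ s s₀) (F-injective s s₀ λ i → trans (sym (t≗Fs i)) (t≗Fs₀ i)))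
        (λ e → let s≗s₀ = does⇒ (_≗?_ _≟A_ s s₀) e in
          cong₂ _∧_ (trans (P-cong s s₀ s≗s₀) Ps₀)
                    (dec-true (_≗?_ _≟B_ t (F s)) λ i → trans (t≗Fs₀ i) (F-cong s₀ s (λ j → sym (s≗s₀ j)) i)))
    ... | false = sym (trans (sumℤ-cong (allFuns n vsA) λ s → cong (λ b → if b then g t else 0ℤ) (outside s))
                             (sumℤ-zero (allFuns n vsA)))
      where
      outside : ∀ s → (P s ∧ does (_≗?_ _≟B_ t (F s))) ≡ false
      outside s = ≢true⇒≡false λ e → contradiction (trans (sym (P⇒Q s (∧-conicalˡ _ _ e)))
        (trans (Q-cong _ _ (λ i → sym (does⇒ (_≗?_ _≟B_ t (F s)) (∧-conicalʳ _ _ e) i))) Qt)) λ ()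

    image : ∀ s → sumℤ (allFuns k vsB) (term s) ≡ (if P s then g (F s) else 0ℤ)
    image s with P s
    ... | true  = allFuns-enumerates _≟B_ enumB k (F s) g g-cong
    ... | false = sumℤ-zero (allFuns k vsB)

  sum-allFuns-reindex : sumℤ (allFuns k vsB) (λ t → if Q t then g t else 0ℤ)
                      ≡ sumℤ (allFuns n vsA) (λ s → if P s then g (F s) else 0ℤ)
  sum-allFuns-reindex = begin
    sumℤ (allFuns k vsB) (λ t → if Q t then g t else 0ℤ)
      ≡⟨ sumℤ-cong (allFuns k vsB) fibre ⟩
    sumℤ (allFuns k vsB) (λ t → sumℤ (allFuns n vsA) (λ s → term s t))
      ≡⟨ sumℤ-swap (allFuns k vsB) (allFuns n vsA) (λ t s → term s t) ⟩
    sumℤ (allFuns n vsA) (λ s → sumℤ (allFuns k vsB) (term s))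
      ≡⟨ sumℤ-cong (allFuns n vsA) image ⟩
    sumℤ (allFuns n vsA) (λ s → if P s then g (F s) else 0ℤ)
      ∎
    where open ≡-Reasoning

sign : Parity → ℤ
sign 0ℙ = 1ℤ
sign 1ℙ = -1ℤ

-1^≡sign : ∀ n → -1ℤ ^ n ≡ sign (parity n)
-1^≡sign zero          = refl
-1^≡sign (suc zero)    = refl
-1^≡sign (suc (suc n)) = trans (trans (sym (ℤ.*-assoc -1ℤ -1ℤ _)) (ℤ.*-identityˡ _)) (-1^≡sign n)

-1^-parity : ∀ m n → parity m ≡ parity n → -1ℤ ^ m ≡ -1ℤ ^ n
-1^-parity m n p = trans (-1^≡sign m) (trans (cong sign p) (sym (-1^≡sign n)))

neg-^ : ∀ x n → (- x) ^ n ≡ -1ℤ ^ n * x ^ n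
neg-^ x zero    = refl
neg-^ x (suc n) = trans (cong ((- x) *_) (neg-^ x n)) (regroup x (-1ℤ ^ n) (x ^ n))
  where
  open +-*-Solver
  regroup : ∀ x s p → (- x) * (s * p) ≡ (-1ℤ * s) * (x * p)
  regroup = solve 3 (λ x s p → (:- x) :* (s :* p) := (con -1ℤ :* s) :* (x :* p)) refl

penrose-term : ∀ x c cr f → parity (c + cr) ≡ parity f → -1ℤ ^ cr * x ^ c ≡ -1ℤ ^ f * (- x) ^ c
penrose-term x c cr f c+cr≡f = sym (begin
  -1ℤ ^ f * (- x) ^ c              ≡⟨ cong (-1ℤ ^ f *_) (neg-^ x c) ⟩
  -1ℤ ^ f * (-1ℤ ^ c * x ^ c)      ≡⟨ ℤ.*-assoc (-1ℤ ^ f) _ _ ⟨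
  -1ℤ ^ f * -1ℤ ^ c * x ^ c        ≡⟨ cong (_* x ^ c) (ℤ.^-distribˡ-+-* -1ℤ f c) ⟨
  -1ℤ ^ (f + c) * x ^ c            ≡⟨ cong (_* x ^ c) (-1^-parity (f + c) cr f+c≡cr) ⟩
  -1ℤ ^ cr * x ^ c                 ∎)
  where
  open ≡-Reasoning
  cancel : ∀ p q → (p ℙ.+ q) ℙ.+ p ≡ q
  cancel 0ℙ 0ℙ = refl
  cancel 0ℙ 1ℙ = refl
  cancel 1ℙ 0ℙ = refl
  cancel 1ℙ 1ℙ = refl
  f+c≡cr : parity (f + c) ≡ parity cr
  f+c≡cr = begin
    parity (f + c)                          ≡⟨ ℙ.+-homo-+ f c ⟩
    parity f ℙ.+ parity c                   ≡⟨ cong (ℙ._+ parity c) (trans (sym c+cr≡f) (ℙ.+-homo-+ c cr)) ⟩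
    (parity c ℙ.+ parity cr) ℙ.+ parity c   ≡⟨ cancel (parity c) (parity cr) ⟩
    parity cr                               ∎

parity-shift : ∀ {a b} c → a ≡ suc b ⊎ b ≡ suc a → parity (a + suc c) ≡ parity (b + c)
parity-shift {a} {b} c (inj₁ refl) = cong (parity ∘ suc) (ℕ.+-suc b c)
parity-shift {a} {b} c (inj₂ refl) = cong parity (ℕ.+-suc a c)

-- The medial graph and the curves of a Penrose state

module MedialGraph (G : EmbeddedGraph) where
  open EmbeddedGraph G using (α; α-invol)

  m : ℕ
  m = EmbeddedGraph.n G

  σ σ⁻¹ : Fin m → Fin m
  σ   = σ⁺ G
  σ⁻¹ = σ⁻ G

  σ∘σ⁻¹ : ∀ d → σ (σ⁻¹ d) ≡ d
  σ∘σ⁻¹ d = inverseʳ (EmbeddedGraph.σ G)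

  σ⁻¹∘σ : ∀ d → σ⁻¹ (σ d) ≡ d
  σ⁻¹∘σ d = inverseˡ (EmbeddedGraph.σ G)

  data HalfEdge : Fin (m + m) → Set where
    at-after  : ∀ d → HalfEdge (after G d)
    at-before : ∀ d → HalfEdge (before G d)

  halfEdge : ∀ h → HalfEdge h
  halfEdge h = subst HalfEdge (F.join-splitAt m m h) (from-split (splitAt m h))
    where
    from-split : ∀ s → HalfEdge (F.join m m s)
    from-split (inj₁ d) = at-after d
    from-split (inj₂ d) = at-before d

  after≢before : ∀ d d' → after G d ≢ before G d'
  after≢before d d' e with trans (sym (F.splitAt-↑ˡ m d m)) (trans (cong (splitAt m) e) (F.splitAt-↑ʳ m m d'))
  ... | ()

  medialμ-after : ∀ d → medialμ G (after G d) ≡ before G (σ d)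
  medialμ-after d rewrite F.splitAt-↑ˡ m d m = refl

  medialμ-before : ∀ d → medialμ G (before G d) ≡ after G (σ⁻¹ d)
  medialμ-before d rewrite F.splitAt-↑ʳ m m d = refl

  medialμ-involutive : ∀ h → medialμ G (medialμ G h) ≡ h
  medialμ-involutive h with halfEdge h
  ... | at-after d  = trans (cong (medialμ G) (medialμ-after d)) (trans (medialμ-before _) (cong (after G) (σ⁻¹∘σ d)))
  ... | at-before d = trans (cong (medialμ G) (medialμ-before d)) (trans (medialμ-after _) (cong (before G) (σ∘σ⁻¹ d)))

  medialVx-after : ∀ d → medialVx G (after G d) ≡ toℕ d ⊓ toℕ (α d)
  medialVx-after d rewrite F.splitAt-↑ˡ m d m = refl

  medialVx-before : ∀ d → medialVx G (before G d) ≡ toℕ d ⊓ toℕ (α d)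
  medialVx-before d rewrite F.splitAt-↑ʳ m m d = refl

  crossing-after : ∀ d → crossing G (after G d) ≡ after G (α d)
  crossing-after d rewrite F.splitAt-↑ˡ m d m = refl

  crossing-before : ∀ d → crossing G (before G d) ≡ before G (α d)
  crossing-before d rewrite F.splitAt-↑ʳ m m d = refl

  whiteSplit-after : ∀ d → whiteSplit G (after G d) ≡ before G (α d)
  whiteSplit-after d rewrite F.splitAt-↑ˡ m d m = refl

  whiteSplit-before : ∀ d → whiteSplit G (before G d) ≡ after G (α d)
  whiteSplit-before d rewrite F.splitAt-↑ʳ m m d = refl

  penroseτ-after : ∀ s d → penroseτ G s (after G d) ≡ (if s d then after G (α d) else before G (α d))
  penroseτ-after s d rewrite F.splitAt-↑ˡ m d m | crossing-after d | whiteSplit-after d = refl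

  penroseτ-before : ∀ s d → penroseτ G s (before G d) ≡ (if s d then before G (α d) else after G (α d))
  penroseτ-before s d rewrite F.splitAt-↑ʳ m m d | crossing-before d | whiteSplit-before d = refl

  penroseτ-cong : ∀ {s s'} → (∀ d → s d ≡ s' d) → ∀ h → penroseτ G s h ≡ penroseτ G s' h
  penroseτ-cong {s} {s'} s≗s' h with halfEdge h
  ... | at-after d  = trans (penroseτ-after s d) (trans (cong (λ b → if b then after G (α d) else before G (α d)) (s≗s' d))
                                                        (sym (penroseτ-after s' d)))
  ... | at-before d = trans (penroseτ-before s d) (trans (cong (λ b → if b then before G (α d) else after G (α d)) (s≗s' d))
                                                         (sym (penroseτ-before s' d)))

  out-after : ∀ col d → Digraph4.out (penroseMedial G col) (after G d) ≡ not (col d)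
  out-after col d rewrite F.splitAt-↑ˡ m d m = refl

  out-before : ∀ col d → Digraph4.out (penroseMedial G col) (before G d) ≡ col (σ⁻¹ d)
  out-before col d rewrite F.splitAt-↑ʳ m m d = refl

  -- Half-edge h lies on the medial edge of the corner (corner h).
  corner : Fin (m + m) → Fin m
  corner h with splitAt m h
  ... | inj₁ d = d
  ... | inj₂ d = σ⁻¹ d

  corner-after : ∀ d → corner (after G d) ≡ d
  corner-after d rewrite F.splitAt-↑ˡ m d m = refl

  corner-before : ∀ d → corner (before G d) ≡ σ⁻¹ d
  corner-before d rewrite F.splitAt-↑ʳ m m d = refl

module Checkerboard (G : EmbeddedGraph) (col : Fin (EmbeddedGraph.n G) → Bool) (chk : IsCheckerboard G col) where
  open MedialGraph G public
  open EmbeddedGraph G using (α; α-invol)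
  open IsCheckerboard chk

  out : Fin (m + m) → Bool
  out = Digraph4.out (penroseMedial G col)

  col-σ⁻¹ : ∀ d → col (σ⁻¹ d) ≡ not (col d)
  col-σ⁻¹ d = ¬-not (alternates d)

  col-σ : ∀ d → col (σ d) ≡ not (col d)
  col-σ d = begin
    col (σ d)                 ≡⟨ not-involutive _ ⟨
    not (not (col (σ d)))     ≡⟨ cong not (col-σ⁻¹ (σ d)) ⟨
    not (col (σ⁻¹ (σ d)))     ≡⟨ cong (not ∘ col) (σ⁻¹∘σ d) ⟩
    not (col d)               ∎
    where open ≡-Reasoning

  col-α : ∀ d → col (α d) ≡ not (col d)
  col-α d = begin
    col (α d)                 ≡⟨ cong (col ∘ α) (σ∘σ⁻¹ d) ⟨
    col (α (σ (σ⁻¹ d)))       ≡⟨ constOnFaces (σ⁻¹ d) ⟩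
    col (σ⁻¹ d)               ≡⟨ col-σ⁻¹ d ⟩
    not (col d)               ∎
    where open ≡-Reasoning

  out-before′ : ∀ d → out (before G d) ≡ not (col d)
  out-before′ d = trans (out-before col d) (col-σ⁻¹ d)

  -- The medial edge of corner c joins after c and before (σ c), directed from tail c to head c.
  head tail : Fin m → Fin (m + m)
  head c = if col c then after G c else before G (σ c)
  tail c = if col c then before G (σ c) else after G c

  corner-head : ∀ c → corner (head c) ≡ c
  corner-head c with col c
  ... | true  = corner-after c
  ... | false = trans (corner-before (σ c)) (σ⁻¹∘σ c)

  corner-tail : ∀ c → corner (tail c) ≡ c
  corner-tail c with col c
  ... | true  = trans (corner-before (σ c)) (σ⁻¹∘σ c)
  ... | false = corner-after c

  out-head : ∀ c → out (head c) ≡ false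
  out-head c with col c in e
  ... | true  = trans (out-after col c) (cong not e)
  ... | false = trans (out-before col (σ c)) (trans (cong col (σ⁻¹∘σ c)) e)

  out-tail : ∀ c → out (tail c) ≡ true
  out-tail c with col c in e
  ... | true  = trans (out-before col (σ c)) (trans (cong col (σ⁻¹∘σ c)) e)
  ... | false = trans (out-after col c) (cong not e)

  head-black : ∀ {c} → col c ≡ true → head c ≡ after G c
  head-black {c} = cong λ b → if b then after G c else before G (σ c)

  head-white : ∀ {c} → col c ≡ false → head c ≡ before G (σ c)
  head-white {c} = cong λ b → if b then after G c else before G (σ c)

  tail-black : ∀ {c} → col c ≡ true → tail c ≡ before G (σ c)
  tail-black {c} = cong λ b → if b then before G (σ c) else after G c

  tail-white : ∀ {c} → col c ≡ false → tail c ≡ after G c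
  tail-white {c} = cong λ b → if b then before G (σ c) else after G c

  head-corner : ∀ h → out h ≡ false → h ≡ head (corner h)
  head-corner h out≡false with halfEdge h
  ... | at-after d = sym (trans (cong head (corner-after d)) (head-black black))
    where
    black : col d ≡ true
    black = not-injective (trans (sym (out-after col d)) out≡false)
  ... | at-before d = sym (trans (cong head (corner-before d))
                             (trans (head-white (trans (col-σ⁻¹ d) (cong not black))) (cong (before G) (σ∘σ⁻¹ d))))
    where
    black : col d ≡ true
    black = not-injective (trans (sym (out-before′ d)) out≡false)

  tail-corner : ∀ h → out h ≡ true → h ≡ tail (corner h)
  tail-corner h out≡true with halfEdge h
  ... | at-after d = sym (trans (cong tail (corner-after d)) (tail-white white))
    where
    white : col d ≡ false
    white = not-injective (trans (sym (out-after col d)) out≡true)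
  ... | at-before d = sym (trans (cong tail (corner-before d))
                             (trans (tail-black (trans (col-σ⁻¹ d) (cong not white))) (cong (before G) (σ∘σ⁻¹ d))))
    where
    white : col d ≡ false
    white = not-injective (trans (sym (out-before′ d)) out≡true)

  medialμ-head : ∀ c → medialμ G (head c) ≡ tail c
  medialμ-head c with col c
  ... | true  = medialμ-after c
  ... | false = trans (medialμ-before (σ c)) (cong (after G) (σ⁻¹∘σ c))

  medialμ-tail : ∀ c → medialμ G (tail c) ≡ head c
  medialμ-tail c with col c
  ... | true  = trans (medialμ-before (σ c)) (cong (after G) (σ⁻¹∘σ c))
  ... | false = medialμ-after c

module PenroseState (G : EmbeddedGraph) (col : Fin (EmbeddedGraph.n G) → Bool) (chk : IsCheckerboard G col)
  (s : Fin (EmbeddedGraph.n G) → Bool) (s-edge : ∀ d → s (EmbeddedGraph.α G d) ≡ s d) where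
  open Checkerboard G col chk public
  open EmbeddedGraph G using (α; α-invol)

  τ : Fin (m + m) → Fin (m + m)
  τ = penroseτ G s

  τ-involutive : ∀ h → τ (τ h) ≡ h
  τ-involutive h with halfEdge h
  ... | at-after d rewrite penroseτ-after s d with s d in e
  ...   | true  rewrite penroseτ-after s (α d) | s-edge d | e | α-invol d = refl
  ...   | false rewrite penroseτ-before s (α d) | s-edge d | e | α-invol d = refl
  τ-involutive h | at-before d rewrite penroseτ-before s d with s d in e
  ...   | true  rewrite penroseτ-before s (α d) | s-edge d | e | α-invol d = refl
  ...   | false rewrite penroseτ-after s (α d) | s-edge d | e | α-invol d = refl

  τ-flips-out : ∀ h → out (τ h) ≡ not (out h)
  τ-flips-out h with halfEdge h
  ... | at-after d rewrite penroseτ-after s d | out-after col d with s d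
  ...   | true  rewrite out-after col (α d) | col-α d = refl
  ...   | false rewrite out-before′ (α d) | col-α d = refl
  τ-flips-out h | at-before d rewrite penroseτ-before s d | out-before′ d with s d
  ...   | true  rewrite out-before′ (α d) | col-α d = refl
  ...   | false rewrite out-after col (α d) | col-α d = refl

  τ-vertex : ∀ h → medialVx G (τ h) ≡ medialVx G h
  τ-vertex h with halfEdge h
  ... | at-after d rewrite penroseτ-after s d | medialVx-after d with s d
  ...   | true  rewrite medialVx-after (α d) | α-invol d = ℕ.⊓-comm _ _
  ...   | false rewrite medialVx-before (α d) | α-invol d = ℕ.⊓-comm _ _
  τ-vertex h | at-before d rewrite penroseτ-before s d | medialVx-before d with s d
  ...   | true  rewrite medialVx-before (α d) | α-invol d = ℕ.⊓-comm _ _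
  ...   | false rewrite medialVx-after (α d) | α-invol d = ℕ.⊓-comm _ _

  -- Following the curves of the state along the direction of the medial graph:
  -- after the medial edge of corner c comes that of corner ρ c.
  ρ ρ⁻¹ : Fin m → Fin m
  ρ   c = corner (τ (head c))
  ρ⁻¹ c = corner (τ (tail c))

  τ-head : ∀ c → τ (head c) ≡ tail (ρ c)
  τ-head c = tail-corner _ (trans (τ-flips-out (head c)) (cong not (out-head c)))

  τ-tail : ∀ c → τ (tail c) ≡ head (ρ⁻¹ c)
  τ-tail c = head-corner _ (trans (τ-flips-out (tail c)) (cong not (out-tail c)))

  ρ∘ρ⁻¹ : ∀ c → ρ (ρ⁻¹ c) ≡ c
  ρ∘ρ⁻¹ c = trans (cong (corner ∘ τ) (sym (τ-tail c))) (trans (cong corner (τ-involutive _)) (corner-tail c))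

  ρ⁻¹∘ρ : ∀ c → ρ⁻¹ (ρ c) ≡ c
  ρ⁻¹∘ρ c = trans (cong (corner ∘ τ) (sym (τ-head c))) (trans (cong corner (τ-involutive _)) (corner-head c))

  π π⁻¹ : Fin (m + m) → Fin (m + m)
  π   h = medialμ G (τ h)
  π⁻¹ h = τ (medialμ G h)

  π∘π⁻¹ : ∀ h → π (π⁻¹ h) ≡ h
  π∘π⁻¹ h = trans (cong (medialμ G) (τ-involutive _)) (medialμ-involutive h)

  π⁻¹∘π : ∀ h → π⁻¹ (π h) ≡ h
  π⁻¹∘π h = trans (cong τ (medialμ-involutive _)) (τ-involutive h)

  iter-π-head : ∀ k c → iter k π (head c) ≡ head (iter k ρ c)
  iter-π-head zero    c = refl
  iter-π-head (suc k) c = trans (cong π (iter-π-head k c))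
                                (trans (cong (medialμ G) (τ-head _)) (medialμ-tail _))

  iter-π-tail : ∀ k c → iter k π (tail c) ≡ tail (iter k ρ⁻¹ c)
  iter-π-tail zero    c = refl
  iter-π-tail (suc k) c = trans (cong π (iter-π-tail k c))
                                (trans (cong (medialμ G) (τ-tail _)) (medialμ-head _))

  open Orbits ρ ρ⁻¹ ρ∘ρ⁻¹ ρ⁻¹∘ρ public
  private module Π = Orbits π π⁻¹ π∘π⁻¹ π⁻¹∘π

  ~-iter-ρ⁻¹ : ∀ k c → c ~ iter k ρ⁻¹ c
  ~-iter-ρ⁻¹ k c = ~-sym (k , iter-inverse ρ∘ρ⁻¹ k c)

  OnCurve : Fin (m + m) → Fin (m + m) → Set
  OnCurve x y = ∃ λ k → iter k π x ≡ y ⊎ τ (iter k π x) ≡ y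

  CornersOnCycle : Fin (m + m) → Set
  CornersOnCycle x = ∀ k → corner x ~ corner (iter k π x) × corner x ~ corner (τ (iter k π x))

  curve-from-head : ∀ c → CornersOnCycle (head c)
  curve-from-head c k rewrite corner-head c | iter-π-head k c | τ-head (iter k ρ c)
                            | corner-head (iter k ρ c) | corner-tail (ρ (iter k ρ c)) = (k , refl) , (suc k , refl)

  curve-from-tail : ∀ c → CornersOnCycle (tail c)
  curve-from-tail c k rewrite corner-tail c | iter-π-tail k c | τ-tail (iter k ρ⁻¹ c)
                            | corner-tail (iter k ρ⁻¹ c) | corner-head (ρ⁻¹ (iter k ρ⁻¹ c)) =
    ~-iter-ρ⁻¹ k c , ~-iter-ρ⁻¹ (suc k) c

  cornersOnCycle : ∀ x → CornersOnCycle x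
  cornersOnCycle x with out x in o
  ... | false = subst CornersOnCycle (sym (head-corner x o)) (curve-from-head (corner x))
  ... | true  = subst CornersOnCycle (sym (tail-corner x o)) (curve-from-tail (corner x))

  onCurve⇒~ : ∀ {x y} → OnCurve x y → corner x ~ corner y
  onCurve⇒~ {x} (k , inj₁ e) = subst (λ w → corner x ~ corner w) e (proj₁ (cornersOnCycle x k))
  onCurve⇒~ {x} (k , inj₂ e) = subst (λ w → corner x ~ corner w) e (proj₂ (cornersOnCycle x k))

  iter-ρ⁻¹-undo : ∀ j {c c'} → iter j ρ c' ≡ c → iter j ρ⁻¹ c ≡ c'
  iter-ρ⁻¹-undo j refl = iter-inverse ρ⁻¹∘ρ j _

  ~⇒onCurve-head : ∀ c y → c ~ corner y → OnCurve (head c) y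
  ~⇒onCurve-head c y c~y with out y in oy
  ... | false = let (j , e) = c~y in
    j , inj₁ (trans (iter-π-head j c) (trans (cong head e) (sym (head-corner y oy))))
  ... | true  = let (j , e) = ~-positive c~y in
    j , inj₂ (trans (cong τ (iter-π-head j c)) (trans (τ-head _) (trans (cong tail e) (sym (tail-corner y oy)))))

  ~⇒onCurve-tail : ∀ c y → c ~ corner y → OnCurve (tail c) y
  ~⇒onCurve-tail c y c~y with out y in oy
  ... | true  = let (j , e) = ~-sym c~y in
    j , inj₁ (trans (iter-π-tail j c) (trans (cong tail (iter-ρ⁻¹-undo j e)) (sym (tail-corner y oy))))
  ... | false = let (j , e) = ~-positive (~-sym c~y) in
    j , inj₂ (trans (cong τ (iter-π-tail j c)) (trans (τ-tail _)
              (trans (cong head (iter-ρ⁻¹-undo (suc j) e)) (sym (head-corner y oy)))))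

  ~⇒onCurve : ∀ {x y} → corner x ~ corner y → OnCurve x y
  ~⇒onCurve {x} {y} x~y with out x in o
  ... | false = subst (λ w → OnCurve w y) (sym (head-corner x o)) (~⇒onCurve-head (corner x) y x~y)
  ... | true  = subst (λ w → OnCurve w y) (sym (tail-corner x o)) (~⇒onCurve-tail (corner x) y x~y)

  curves-marksLeast : MarksLeast (λ x y → corner x ~ corner y)
    (λ x → all (λ k → (toℕ x ≤ᵇ toℕ (iter k π x)) ∧ (toℕ x ≤ᵇ toℕ (τ (iter k π x)))) (upTo (m + m)))
  curves-marksLeast x = mk⇔ to from
    where
    to : _ → IsLeast (λ x y → corner x ~ corner y) x
    to test y x~y with ~⇒onCurve x~y
    ... | k , on = let (k' , k'<N , e) = Π.~-bounded (k , refl)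
                       both = Equivalence.to (all-upTo (m + m) _) test k' k'<N
                       x≤πx = ∧-conicalˡ _ _ both
                       x≤τπx = ∧-conicalʳ _ _ both in
      [ (λ πᵏx≡y → subst (λ w → toℕ x ≤ toℕ w) (trans e πᵏx≡y) (≤ᵇ⇒≤ x≤πx)) ,
        (λ τπᵏx≡y → subst (λ w → toℕ x ≤ toℕ w) (trans (cong τ e) τπᵏx≡y) (≤ᵇ⇒≤ x≤τπx)) ]′ on
    from : IsLeast (λ x y → corner x ~ corner y) x → _
    from least = Equivalence.from (all-upTo (m + m) _) λ k _ →
      cong₂ _∧_ (≤⇒≤ᵇ (least _ (onCurve⇒~ (k , inj₁ refl)))) (≤⇒≤ᵇ (least _ (onCurve⇒~ (k , inj₂ refl))))

  -- Each curve consists of the half-edges of the medial edges of the corners in one cycle of ρ.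
  curves≡orbits : curves (m + m) (medialμ G) τ ≡ orbits m ρ
  curves≡orbits = count-classes-pullback ~-isDecEquivalence corner (after G) corner-after
                    curves-marksLeast orbits-marksLeast

module WhiteState (G : EmbeddedGraph) (col : Fin (EmbeddedGraph.n G) → Bool) (chk : IsCheckerboard G col) where
  open PenroseState G col chk (λ _ → false) (λ _ → refl)
  open EmbeddedGraph G using (α; α-invol)
  open IsCheckerboard chk

  φ φ⁻¹ : Fin m → Fin m
  φ   d = α (σ d)
  φ⁻¹ d = σ⁻¹ (α d)

  φ∘φ⁻¹ : ∀ d → φ (φ⁻¹ d) ≡ d
  φ∘φ⁻¹ d = trans (cong α (σ∘σ⁻¹ _)) (α-invol d)

  φ⁻¹∘φ : ∀ d → φ⁻¹ (φ d) ≡ d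
  φ⁻¹∘φ d = trans (cong σ⁻¹ (α-invol _)) (σ⁻¹∘σ d)

  col-φ⁻¹ : ∀ d → col (φ⁻¹ d) ≡ col d
  col-φ⁻¹ d = sym (trans (cong col (sym (φ∘φ⁻¹ d))) (constOnFaces (φ⁻¹ d)))

  -- In the all-white state the curves run around the faces: forwards along the
  -- white ones and backwards along the black ones.
  ρ-black : ∀ {c} → col c ≡ true → ρ c ≡ φ⁻¹ c
  ρ-black {c} black = begin
    corner (τ (head c))          ≡⟨ cong (corner ∘ τ) (head-black black) ⟩
    corner (τ (after G c))       ≡⟨ cong corner (penroseτ-after _ c) ⟩
    corner (before G (α c))      ≡⟨ corner-before (α c) ⟩
    φ⁻¹ c                        ∎
    where open ≡-Reasoning

  ρ-white : ∀ {c} → col c ≡ false → ρ c ≡ φ c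
  ρ-white {c} white = begin
    corner (τ (head c))          ≡⟨ cong (corner ∘ τ) (head-white white) ⟩
    corner (τ (before G (σ c)))  ≡⟨ cong corner (penroseτ-before _ (σ c)) ⟩
    corner (after G (φ c))       ≡⟨ corner-after (φ c) ⟩
    φ c                          ∎
    where open ≡-Reasoning

  iter-ρ-black : ∀ k {c} → col c ≡ true → iter k ρ c ≡ iter k φ⁻¹ c × col (iter k φ⁻¹ c) ≡ true
  iter-ρ-black zero    black = refl , black
  iter-ρ-black (suc k) black = let (ρᵏ≡φ⁻ᵏ , black′) = iter-ρ-black k black in
    trans (cong ρ ρᵏ≡φ⁻ᵏ) (ρ-black black′) , trans (col-φ⁻¹ _) black′

  iter-ρ-white : ∀ k {c} → col c ≡ false → iter k ρ c ≡ iter k φ c × col (iter k φ c) ≡ false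
  iter-ρ-white zero    white = refl , white
  iter-ρ-white (suc k) white = let (ρᵏ≡φᵏ , white′) = iter-ρ-white k white in
    trans (cong ρ ρᵏ≡φᵏ) (ρ-white white′) , trans (constOnFaces _) white′

  private module Φ = Orbits φ φ⁻¹ φ∘φ⁻¹ φ⁻¹∘φ

  ~⇔~φ : ∀ x y → x ~ y ⇔ x Φ.~ y
  ~⇔~φ x y with col x in cx
  ... | true  = mk⇔
    (λ (k , ρᵏx≡y) → let φ⁻ᵏx≡y = trans (sym (proj₁ (iter-ρ-black k cx))) ρᵏx≡y in
       Φ.~-sym (k , trans (cong (iter k φ) (sym φ⁻ᵏx≡y)) (iter-inverse φ∘φ⁻¹ k x)))
    (λ x~y → let (k , φᵏy≡x) = Φ.~-sym x~y in
       k , trans (proj₁ (iter-ρ-black k cx)) (trans (cong (iter k φ⁻¹) (sym φᵏy≡x)) (iter-inverse φ⁻¹∘φ k y)))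
  ... | false = mk⇔ (λ (k , ρᵏx≡y) → k , trans (sym (proj₁ (iter-ρ-white k cx))) ρᵏx≡y)
                    (λ (k , φᵏx≡y) → k , trans (proj₁ (iter-ρ-white k cx)) φᵏx≡y)

  orbits-white : orbits m ρ ≡ orbits m φ
  orbits-white = count-marksLeast-unique ~⇔~φ orbits-marksLeast Φ.orbits-marksLeast

-- Turning the white split at the edge of the black dart u into a crossing
-- composes the corner permutation with the transposition of u and σ⁻¹ u.
module Switch (G : EmbeddedGraph) (col : Fin (EmbeddedGraph.n G) → Bool) (chk : IsCheckerboard G col)
  (s s' : Fin (EmbeddedGraph.n G) → Bool)
  (s-edge : ∀ d → s (EmbeddedGraph.α G d) ≡ s d) (s'-edge : ∀ d → s' (EmbeddedGraph.α G d) ≡ s' d)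
  (u : Fin (EmbeddedGraph.n G)) (u-black : col u ≡ true) (s-u : s u ≡ false) (s'-u : s' u ≡ true)
  (elsewhere : ∀ d → d ≢ u → d ≢ EmbeddedGraph.α G u → s' d ≡ s d) where
  open EmbeddedGraph G using (α)
  private
    module S  = PenroseState G col chk s s-edge
    module S' = PenroseState G col chk s' s'-edge
  open Checkerboard G col chk

  αu-white : col (α u) ≡ false
  αu-white = trans (col-α u) (cong not u-black)

  black≢αu : ∀ {d} → col d ≡ true → d ≢ α u
  black≢αu black refl with () ← trans (sym black) αu-white

  u≢σ⁻¹u : u ≢ σ⁻¹ u
  u≢σ⁻¹u e with () ← trans (sym u-black) (trans (cong col e) (trans (col-σ⁻¹ u) (cong not u-black)))

  head-σ⁻¹u : head (σ⁻¹ u) ≡ before G u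
  head-σ⁻¹u = trans (head-white (trans (col-σ⁻¹ u) (cong not u-black))) (cong (before G) (σ∘σ⁻¹ u))

  ρ'-u : S'.ρ u ≡ S.ρ (σ⁻¹ u)
  ρ'-u = begin
    corner (S'.τ (head u))            ≡⟨ cong (corner ∘ S'.τ) (head-black u-black) ⟩
    corner (S'.τ (after G u))         ≡⟨ cong corner (trans (penroseτ-after s' u) (cong (λ b → if b then _ else _) s'-u)) ⟩
    corner (after G (α u))            ≡⟨ cong corner (trans (penroseτ-before s u) (cong (λ b → if b then _ else _) s-u)) ⟨
    corner (S.τ (before G u))         ≡⟨ cong (corner ∘ S.τ) head-σ⁻¹u ⟨
    corner (S.τ (head (σ⁻¹ u)))       ∎
    where open ≡-Reasoning

  ρ'-σ⁻¹u : S'.ρ (σ⁻¹ u) ≡ S.ρ u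
  ρ'-σ⁻¹u = begin
    corner (S'.τ (head (σ⁻¹ u)))      ≡⟨ cong (corner ∘ S'.τ) head-σ⁻¹u ⟩
    corner (S'.τ (before G u))        ≡⟨ cong corner (trans (penroseτ-before s' u) (cong (λ b → if b then _ else _) s'-u)) ⟩
    corner (before G (α u))           ≡⟨ cong corner (trans (penroseτ-after s u) (cong (λ b → if b then _ else _) s-u)) ⟨
    corner (S.τ (after G u))          ≡⟨ cong (corner ∘ S.τ) (head-black u-black) ⟨
    corner (S.τ (head u))             ∎
    where open ≡-Reasoning

  agree-after : ∀ {d} → d ≢ u → d ≢ α u → S'.τ (after G d) ≡ S.τ (after G d)
  agree-after {d} d≢u d≢αu = trans (penroseτ-after s' d)
    (trans (cong (λ b → if b then after G (α d) else before G (α d)) (elsewhere d d≢u d≢αu)) (sym (penroseτ-after s d)))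

  agree-before : ∀ {d} → d ≢ u → d ≢ α u → S'.τ (before G d) ≡ S.τ (before G d)
  agree-before {d} d≢u d≢αu = trans (penroseτ-before s' d)
    (trans (cong (λ b → if b then before G (α d) else after G (α d)) (elsewhere d d≢u d≢αu)) (sym (penroseτ-before s d)))

  agree-head : ∀ c → c ≢ u → c ≢ σ⁻¹ u → S'.τ (head c) ≡ S.τ (head c)
  agree-head c c≢u c≢σ⁻¹u with col c in cc
  ... | true  = agree-after c≢u (black≢αu cc)
  ... | false = agree-before (λ σc≡u → c≢σ⁻¹u (trans (sym (σ⁻¹∘σ c)) (cong σ⁻¹ σc≡u)))
                             (black≢αu (trans (col-σ c) (cong not cc)))

  ρ'≗ρ∘transpose : ∀ c → S'.ρ c ≡ S.ρ (transpose u (σ⁻¹ u) c)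
  ρ'≗ρ∘transpose c = by-cases (c F.≟ u) (c F.≟ σ⁻¹ u)
    where
    by-cases : Dec (c ≡ u) → Dec (c ≡ σ⁻¹ u) → S'.ρ c ≡ S.ρ (transpose u (σ⁻¹ u) c)
    by-cases (yes refl) _ = trans ρ'-u (cong S.ρ (sym (transpose-matchˡ u (σ⁻¹ u))))
    by-cases (no _) (yes refl) = trans ρ'-σ⁻¹u (cong S.ρ (sym (transpose-matchʳ u (σ⁻¹ u))))
    by-cases (no c≢u) (no c≢σ⁻¹u) =
      trans (cong corner (agree-head c c≢u c≢σ⁻¹u)) (cong S.ρ (sym (transpose-other c≢u c≢σ⁻¹u)))

  orbits-switch : orbits m S.ρ ≡ suc (orbits m S'.ρ) ⊎ orbits m S'.ρ ≡ suc (orbits m S.ρ)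
  orbits-switch = orbits-transpose S.ρ S.ρ⁻¹ S.ρ∘ρ⁻¹ S.ρ⁻¹∘ρ u (σ⁻¹ u) u≢σ⁻¹u S'.ρ ρ'≗ρ∘transpose

module CurveParity (G : EmbeddedGraph) (col : Fin (EmbeddedGraph.n G) → Bool) (chk : IsCheckerboard G col) where
  open EmbeddedGraph G using (α; α-invol; α-fpf)
  open Checkerboard G col chk
  open WhiteState G col chk using (φ; orbits-white)

  -- cr counts each crossing edge {d, α d} at its dart with d < α d.
  ordered : Fin m → Bool
  ordered d = toℕ d <ᵇ toℕ (α d)

  ordered-either : ∀ d → ordered d ≡ true ⊎ ordered (α d) ≡ true
  ordered-either d with ℕ.<-cmp (toℕ d) (toℕ (α d))
  ... | tri< lt _ _ = inj₁ (<⇒<ᵇ lt)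
  ... | tri≈ _ eq _ = contradiction (sym (F.toℕ-injective eq)) (α-fpf d)
  ... | tri> _ _ gt = inj₂ (subst (λ v → (toℕ (α d) <ᵇ toℕ v) ≡ true) (sym (α-invol d)) (<⇒<ᵇ gt))

  ordered-α : ∀ {d} → ordered d ≡ true → ordered (α d) ≡ false
  ordered-α {d} o = ≢true⇒≡false λ o' →
    ℕ.<-asym (<ᵇ⇒< o) (subst (toℕ (α d) <_) (cong toℕ (α-invol d)) (<ᵇ⇒< o'))

  α-== : ∀ x y → (α x == y) ≡ (x == α y)
  α-== x y = bool-ext (λ e → ≡⇒== (trans (sym (α-invol x)) (cong α (==⇒≡ e))))
                      (λ e → ≡⇒== (trans (cong α (==⇒≡ e)) (α-invol y)))

  onEdge : Fin m → Fin m → Bool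
  onEdge d₀ d = (d == d₀) ∨ (d == α d₀)

  onEdge-α : ∀ d₀ d → onEdge d₀ (α d) ≡ onEdge d₀ d
  onEdge-α d₀ d = begin
    (α d == d₀) ∨ (α d == α d₀)
      ≡⟨ cong₂ _∨_ (α-== d d₀) (trans (α-== d (α d₀)) (cong (d ==_) (α-invol d₀))) ⟩
    (d == α d₀) ∨ (d == d₀)          ≡⟨ ∨-comm (d == α d₀) (d == d₀) ⟩
    (d == d₀) ∨ (d == α d₀)          ∎
    where open ≡-Reasoning

  removeEdge : (Fin m → Bool) → Fin m → Fin m → Bool
  removeEdge s d₀ d = s d ∧ not (onEdge d₀ d)

  removeEdge-edge : ∀ {s} → (∀ d → s (α d) ≡ s d) → ∀ d₀ d → removeEdge s d₀ (α d) ≡ removeEdge s d₀ d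
  removeEdge-edge s-edge d₀ d = cong₂ (λ x y → x ∧ not y) (s-edge d) (onEdge-α d₀ d)

  cr-removeEdge : ∀ s d₀ → s d₀ ∧ ordered d₀ ≡ true → cr G s ≡ suc (cr G (removeEdge s d₀))
  cr-removeEdge s d₀ crossing = count-insert m d₀ split
    where
    split : ∀ d → indicator (s d ∧ ordered d) ≡ indicator (removeEdge s d₀ d ∧ ordered d) + indicator (d == d₀)
    split d with d F.≟ d₀
    ... | yes refl rewrite crossing | ∧-zeroʳ (s d) = refl
    ... | no d≢d₀ with d F.≟ α d₀
    ...   | yes refl rewrite ordered-α (∧-conicalʳ _ _ crossing) | ∧-zeroʳ (s (α d₀)) = refl
    ...   | no d≢αd₀ =
      sym (trans (ℕ.+-identityʳ _) (cong (λ b → indicator (b ∧ ordered d)) (∧-identityʳ (s d))))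

  no-crossings : ∀ s → (∀ d → s (α d) ≡ s d) → cr G s ≡ 0 → ∀ d → s d ≡ false
  no-crossings s s-edge cr≡0 d with ordered-either d
  ... | inj₁ o = trans (sym (∧-identityʳ (s d))) (trans (cong (s d ∧_) (sym o)) (count≡0⇒false m _ cr≡0 d))
  ... | inj₂ o = trans (sym (s-edge d))
                   (trans (sym (∧-identityʳ _)) (trans (cong (s (α d) ∧_) (sym o)) (count≡0⇒false m _ cr≡0 (α d))))

  black-end : ∀ d₀ → ∃ λ u → col u ≡ true × (u ≡ d₀ ⊎ u ≡ α d₀)
  black-end d₀ with col d₀ in c
  ... | true  = d₀ , c , inj₁ refl
  ... | false = α d₀ , trans (col-α d₀) (cong not c) , inj₂ refl

  onEdge-end : ∀ {d₀ u} → u ≡ d₀ ⊎ u ≡ α d₀ → ∀ d → onEdge u d ≡ onEdge d₀ d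
  onEdge-end (inj₁ refl) d = refl
  onEdge-end {d₀} (inj₂ refl) d =
    trans (cong ((d == α d₀) ∨_) (cong (d ==_) (α-invol d₀))) (∨-comm (d == α d₀) (d == d₀))

  onEdge-end-self : ∀ {d₀ u} → u ≡ d₀ ⊎ u ≡ α d₀ → onEdge d₀ u ≡ true
  onEdge-end-self {d₀} (inj₁ refl) = cong (_∨ (d₀ == α d₀)) (≡⇒== refl)
  onEdge-end-self {d₀} (inj₂ refl) = trans (cong ((α d₀ == d₀) ∨_) (≡⇒== refl)) (∨-zeroʳ _)

  onEdge-off : ∀ {d₀ d} → d ≢ d₀ → d ≢ α d₀ → onEdge d₀ d ≡ false
  onEdge-off d≢d₀ d≢αd₀ = cong₂ _∨_ (≢⇒==false d≢d₀) (≢⇒==false d≢αd₀)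

  edge-end : ∀ {s : Fin m → Bool} {d₀ u} → (∀ d → s (α d) ≡ s d) → u ≡ d₀ ⊎ u ≡ α d₀ → s u ≡ s d₀
  edge-end s-edge (inj₁ refl) = refl
  edge-end s-edge (inj₂ refl) = s-edge _

  curvesOf : (Fin m → Bool) → ℕ
  curvesOf s = curves (m + m) (medialμ G) (penroseτ G s)

  curves-removeEdge : ∀ s (s-edge : ∀ d → s (α d) ≡ s d) d₀ → s d₀ ≡ true →
    curvesOf s ≡ suc (curvesOf (removeEdge s d₀)) ⊎ curvesOf (removeEdge s d₀) ≡ suc (curvesOf s)
  curves-removeEdge s s-edge d₀ s-d₀ with black-end d₀
  ... | u , u-black , u-end =
    Sum.map (λ e → trans C≡ (trans e (cong suc (sym C'≡)))) (λ e → trans C'≡ (trans e (cong suc (sym C≡))))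
      (Sum.swap (Switch.orbits-switch G col chk (removeEdge s d₀) s (removeEdge-edge s-edge d₀) s-edge
                                           u u-black s'-u s-u elsewhere))
    where
    C≡ : curvesOf s ≡ orbits m (PenroseState.ρ G col chk s s-edge)
    C≡ = PenroseState.curves≡orbits G col chk s s-edge
    C'≡ : curvesOf (removeEdge s d₀) ≡ orbits m (PenroseState.ρ G col chk (removeEdge s d₀) (removeEdge-edge s-edge d₀))
    C'≡ = PenroseState.curves≡orbits G col chk (removeEdge s d₀) (removeEdge-edge s-edge d₀)
    s-u : s u ≡ true
    s-u = trans (edge-end {s = s} s-edge u-end) s-d₀
    s'-u : removeEdge s d₀ u ≡ false
    s'-u = trans (cong (λ b → s u ∧ not b) (onEdge-end-self u-end)) (∧-zeroʳ (s u))
    elsewhere : ∀ d → d ≢ u → d ≢ α u → s d ≡ removeEdge s d₀ d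
    elsewhere d d≢u d≢αu = sym (trans (cong (λ b → s d ∧ not b) (trans (sym (onEdge-end u-end d)) (onEdge-off d≢u d≢αu)))
                                      (∧-identityʳ (s d)))

  curves-parity : ∀ k s → (∀ d → s (α d) ≡ s d) → cr G s ≡ k → parity (curvesOf s + cr G s) ≡ parity (orbits m φ)
  curves-parity zero s s-edge cr≡0 = cong parity (trans (cong₂ _+_ curves-white cr≡0) (ℕ.+-identityʳ _))
    where
    all-white : ∀ d → s d ≡ false
    all-white = no-crossings s s-edge cr≡0
    curves-white : curvesOf s ≡ orbits m φ
    curves-white = begin
      curvesOf s                                             ≡⟨ PenroseState.curves≡orbits G col chk s s-edge ⟩
      orbits m (PenroseState.ρ G col chk s s-edge)
        ≡⟨ orbits-cong m (λ c → cong corner (penroseτ-cong all-white (head c))) ⟩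
      orbits m (PenroseState.ρ G col chk (λ _ → false) (λ _ → refl))  ≡⟨ orbits-white ⟩
      orbits m φ                                             ∎
      where open ≡-Reasoning
  curves-parity (suc k) s s-edge cr≡1+k with count≡suc⇒witness m _ cr≡1+k
  ... | d₀ , crossing = begin
    parity (curvesOf s + cr G s)             ≡⟨ cong (λ n → parity (curvesOf s + n)) cr≡1+cr' ⟩
    parity (curvesOf s + suc (cr G s'))      ≡⟨ parity-shift (cr G s') (curves-removeEdge s s-edge d₀ (∧-conicalˡ _ _ crossing)) ⟩
    parity (curvesOf s' + cr G s')           ≡⟨ curves-parity k s' (removeEdge-edge s-edge d₀) cr'≡k ⟩
    parity (orbits m φ)                      ∎
    where
    open ≡-Reasoning
    s' : Fin m → Bool
    s' = removeEdge s d₀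
    cr≡1+cr' : cr G s ≡ suc (cr G s')
    cr≡1+cr' = cr-removeEdge s d₀ crossing
    cr'≡k : cr G s' ≡ k
    cr'≡k = ℕ.suc-injective (trans (sym cr≡1+cr') cr≡1+k)

-- Penrose states as directed states

module DirectedStates (G : EmbeddedGraph) (col : Fin (EmbeddedGraph.n G) → Bool) (chk : IsCheckerboard G col) where
  open EmbeddedGraph G using (α; α-invol)
  open Checkerboard G col chk

  D : Digraph4
  D = penroseMedial G col

  isDirected : (Fin (m + m) → Fin (m + m)) → Bool
  isDirected τ = isState D τ ∧ isDirState D τ

  isDirected-cong : ∀ {τ τ'} → (∀ h → τ h ≡ τ' h) → isDirected τ ≡ isDirected τ'
  isDirected-cong {τ} {τ'} τ≗τ' = cong₂ _∧_
    (all-cong (λ h → cong₂ _∧_ (cong (_== h) (trans (τ≗τ' _) (cong τ' (τ≗τ' h))))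
                 (cong₂ _∧_ (cong (λ x → not (x == h)) (τ≗τ' h))
                            (cong (λ x → medialVx G x ≡ᵇ medialVx G h) (τ≗τ' h))))
              (allFin (m + m)))
    (all-cong (λ h → cong (λ x → out x xor out h) (τ≗τ' h)) (allFin (m + m)))

  penroseτ-isDirected : ∀ s → (∀ d → s (α d) ≡ s d) → isDirected (penroseτ G s) ≡ true
  penroseτ-isDirected s s-edge = cong₂ _∧_
    (Equivalence.from (all-allFin _) λ h → cong₂ _∧_ (≡⇒== (τ-involutive h))
      (cong₂ _∧_ (cong not (≢⇒==false (λ τh≡h → xor⇒≢ (not-xor-self (out h))
                    (trans (sym (τ-flips-out h)) (cong out τh≡h)))))
                 (trans (cong (_≡ᵇ medialVx G h) (τ-vertex h)) (≡ᵇ-refl (medialVx G h)))))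
    (Equivalence.from (all-allFin _) λ h → trans (cong (_xor out h) (τ-flips-out h)) (not-xor-self (out h)))
    where open PenroseState G col chk s s-edge using (τ-involutive; τ-flips-out; τ-vertex)

  penroseτ-injective : ∀ s s' → (∀ h → penroseτ G s h ≡ penroseτ G s' h) → ∀ d → s d ≡ s' d
  penroseτ-injective s s' τ≗τ' d =
    choice-injective (s d) (s' d) (trans (sym (penroseτ-after s d)) (trans (τ≗τ' _) (penroseτ-after s' d)))
    where
    choice-injective : ∀ b b' → (if b  then after G (α d) else before G (α d))
                              ≡ (if b' then after G (α d) else before G (α d)) → b ≡ b'
    choice-injective true  true  _ = refl
    choice-injective false false _ = refl
    choice-injective true  false e = contradiction e (after≢before _ _)
    choice-injective false true  e = contradiction (sym e) (after≢before _ _)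

  same-edge : ∀ d d' → toℕ d' ⊓ toℕ (α d') ≡ toℕ d ⊓ toℕ (α d) → d' ≡ d ⊎ d' ≡ α d
  same-edge d d' e with ℕ.⊓-sel (toℕ d') (toℕ (α d')) | ℕ.⊓-sel (toℕ d) (toℕ (α d))
  ... | inj₁ p' | inj₁ p = inj₁ (F.toℕ-injective (trans (sym p') (trans e p)))
  ... | inj₁ p' | inj₂ p = inj₂ (F.toℕ-injective (trans (sym p') (trans e p)))
  ... | inj₂ p' | inj₁ p = inj₂ (trans (sym (α-invol d')) (cong α (F.toℕ-injective (trans (sym p') (trans e p)))))
  ... | inj₂ p' | inj₂ p =
    inj₁ (trans (sym (α-invol d')) (trans (cong α (F.toℕ-injective (trans (sym p') (trans e p)))) (α-invol d)))

  AtEdge : Fin m → Fin (m + m) → Set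
  AtEdge d h = (h ≡ after G d ⊎ h ≡ before G d) ⊎ (h ≡ after G (α d) ⊎ h ≡ before G (α d))

  atEdge : ∀ d h → medialVx G h ≡ toℕ d ⊓ toℕ (α d) → AtEdge d h
  atEdge d h vx≡ with halfEdge h
  ... | at-after d'  with same-edge d d' (trans (sym (medialVx-after d')) vx≡)
  ...   | inj₁ refl = inj₁ (inj₁ refl)
  ...   | inj₂ refl = inj₂ (inj₁ refl)
  atEdge d h vx≡ | at-before d' with same-edge d d' (trans (sym (medialVx-before d')) vx≡)
  ...   | inj₁ refl = inj₁ (inj₂ refl)
  ...   | inj₂ refl = inj₂ (inj₂ refl)

  module FromDirected (τ : Fin (m + m) → Fin (m + m)) (directed : isDirected τ ≡ true) where
    private
      state : ∀ h → ((τ (τ h) == h) ∧ not (τ h == h) ∧ (medialVx G (τ h) ≡ᵇ medialVx G h)) ≡ true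
      state = Equivalence.to (all-allFin _) (∧-conicalˡ _ _ directed)

    τ-involutive : ∀ h → τ (τ h) ≡ h
    τ-involutive h = ==⇒≡ (∧-conicalˡ _ _ (state h))

    τ-injective : ∀ {h h'} → τ h ≡ τ h' → h ≡ h'
    τ-injective {h} {h'} e = trans (sym (τ-involutive h)) (trans (cong τ e) (τ-involutive h'))

    τ-vertex : ∀ h → medialVx G (τ h) ≡ medialVx G h
    τ-vertex h = ℕ.≡ᵇ⇒≡ _ _ (Equivalence.from T-≡
      (∧-conicalʳ (not (τ h == h)) _ (∧-conicalʳ (τ (τ h) == h) _ (state h))))

    τ-flips : ∀ h → out (τ h) ≢ out h
    τ-flips h = xor⇒≢ (Equivalence.to (all-allFin _) (∧-conicalʳ _ _ directed) h)

    -- after d and before d point the same way, so τ pairs them with half-edges of α d.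
    opposite : ∀ d {h} → h ≡ after G d ⊎ h ≡ before G d → τ h ≡ after G (α d) ⊎ τ h ≡ before G (α d)
    opposite d {h} h-at-d with atEdge d (τ h) (trans (τ-vertex h) (vx-at h-at-d))
      where
      vx-at : ∀ {h} → h ≡ after G d ⊎ h ≡ before G d → medialVx G h ≡ toℕ d ⊓ toℕ (α d)
      vx-at (inj₁ refl) = medialVx-after d
      vx-at (inj₂ refl) = medialVx-before d
    ... | inj₂ τh-at-αd = τh-at-αd
    ... | inj₁ τh-at-d  = contradiction (trans (out-at τh-at-d) (sym (out-at h-at-d))) (τ-flips h)
      where
      out-at : ∀ {h} → h ≡ after G d ⊎ h ≡ before G d → out h ≡ not (col d)
      out-at (inj₁ refl) = out-after col d
      out-at (inj₂ refl) = out-before′ d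

    crossesAt : Fin m → Bool
    crossesAt d = does (τ (after G d) F.≟ after G (α d))

    crossesAt-edge : ∀ d → crossesAt (α d) ≡ crossesAt d
    crossesAt-edge d = does-≡ (τ (after G (α d)) F.≟ after G (α (α d))) (map′
      (λ e → trans (cong τ (sym e)) (trans (τ-involutive _) (cong (after G) (sym (α-invol d)))))
      (λ e → trans (cong τ (trans (cong (after G) (sym (α-invol d))) (sym e))) (τ-involutive _))
      (τ (after G d) F.≟ after G (α d)))

    τ-after : ∀ d → τ (after G d) ≡ (if crossesAt d then after G (α d) else before G (α d))
    τ-after d with opposite d (inj₁ refl)
    ... | inj₁ e rewrite dec-true  (τ (after G d) F.≟ after G (α d)) e = e
    ... | inj₂ e rewrite dec-false (τ (after G d) F.≟ after G (α d)) (λ e' → after≢before _ _ (trans (sym e') e)) = e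

    τ-before : ∀ d → τ (before G d) ≡ (if crossesAt d then before G (α d) else after G (α d))
    τ-before d with opposite d (inj₂ refl) | crossesAt d | τ-after d
    ... | inj₂ e | true  | _     = e
    ... | inj₁ e | false | _     = e
    ... | inj₁ e | true  | τa≡a  = contradiction (τ-injective (trans τa≡a (sym e))) (after≢before d d)
    ... | inj₂ e | false | τa≡b  = contradiction (τ-injective (trans τa≡b (sym e))) (after≢before d d)

    τ≗penroseτ : ∀ h → τ h ≡ penroseτ G crossesAt h
    τ≗penroseτ h with halfEdge h
    ... | at-after d  = trans (τ-after d) (sym (penroseτ-after crossesAt d))
    ... | at-before d = trans (τ-before d) (sym (penroseτ-before crossesAt d))

module PenroseViaCircuits (G : EmbeddedGraph) (col : Fin (EmbeddedGraph.n G) → Bool) (chk : IsCheckerboard G col) where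
  open EmbeddedGraph G using (α; isolated)
  open Checkerboard G col chk using (m; penroseτ-cong)
  open DirectedStates G col chk
  open CurveParity G col chk using (curves-parity; curvesOf)

  dartLabellings : List (Fin m → Bool)
  dartLabellings = allFuns m (false ∷ true ∷ [])

  isEdgeFunction⇔ : ∀ s → IsEdgeFunction G s ≡ true ⇔ (∀ d → s (α d) ≡ s d)
  isEdgeFunction⇔ s = mk⇔
    (λ e d → xnor⇒≡ (Equivalence.to (all-allFin _) e d))
    (λ s-edge → Equivalence.from (all-allFin _) λ d → trans (cong (λ b → not (b xor s d)) (s-edge d)) (cong not (xor-same (s d))))
    where
    xnor⇒≡ : ∀ {a b} → not (a xor b) ≡ true → a ≡ b
    xnor⇒≡ {false} {false} _ = refl
    xnor⇒≡ {true}  {true}  _ = refl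

  c+cr≡faces : ∀ s → (∀ d → s (α d) ≡ s d) → parity (c G s + cr G s) ≡ parity (faces G)
  c+cr≡faces s s-edge = begin
    parity (curvesOf s + isolated + cr G s)               ≡⟨ cong parity (xy∙z≈xz∙y (curvesOf s) isolated (cr G s)) ⟩
    parity (curvesOf s + cr G s + isolated)               ≡⟨ ℙ.+-homo-+ (curvesOf s + cr G s) isolated ⟩
    parity (curvesOf s + cr G s) ℙ.+ parity isolated      ≡⟨ cong (ℙ._+ parity isolated) (curves-parity _ s s-edge refl) ⟩
    parity (orbits m (λ d → α (σ⁺ G d))) ℙ.+ parity isolated  ≡⟨ ℙ.+-homo-+ (orbits m (λ d → α (σ⁺ G d))) isolated ⟨
    parity (faces G)                                      ∎
    where open ≡-Reasoning

  penrose-as-sum : ∀ x → penrose G x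
                 ≡ -1ℤ ^ faces G * sumℤ dartLabellings (λ s → if IsEdgeFunction G s then (- x) ^ c G s else 0ℤ)
  penrose-as-sum x = trans (sumℤ-cong dartLabellings term) (sumℤ-*ˡ (-1ℤ ^ faces G) dartLabellings _)
    where
    term : ∀ s → (if IsEdgeFunction G s then -1ℤ ^ cr G s * x ^ c G s else 0ℤ)
               ≡ -1ℤ ^ faces G * (if IsEdgeFunction G s then (- x) ^ c G s else 0ℤ)
    term s with IsEdgeFunction G s in E
    ... | true  = penrose-term x (c G s) (cr G s) (faces G) (c+cr≡faces s (Equivalence.to (isEdgeFunction⇔ s) E))
    ... | false = sym (ℤ.*-zeroʳ (-1ℤ ^ faces G))

  circuitPartition-as-sum : ∀ y → circuitPartition (penroseMedial G col) y
                                ≡ sumℤ dartLabellings (λ s → if IsEdgeFunction G s then y ^ c G s else 0ℤ)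
  circuitPartition-as-sum y = sum-allFuns-reindex {_≟A_ = Bool._≟_} {_≟B_ = F._≟_} bools-enumerate (allFin-enumerates (m + m))
    (IsEdgeFunction G) isDirected (penroseτ G) (λ τ → y ^ (curves (m + m) (medialμ G) τ + isolated))
    (λ s s' s≗s' → all-cong (λ d → cong₂ (λ a b → not (a xor b)) (s≗s' (α d)) (s≗s' d)) (allFin m))
    (λ _ _ → isDirected-cong)
    (λ τ τ' τ≗τ' → cong (λ k → y ^ (k + isolated)) (curves-cong (m + m) (medialμ G) τ≗τ'))
    (λ _ _ → penroseτ-cong)
    penroseτ-injective
    (λ s E → penroseτ-isDirected s (Equivalence.to (isEdgeFunction⇔ s) E))
    (λ τ directed → let open FromDirected τ directed in
       crossesAt , Equivalence.from (isEdgeFunction⇔ crossesAt) crossesAt-edge , τ≗penroseτ)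

theorem6p2 : (G : EmbeddedGraph) (col : Fin (EmbeddedGraph.n G) → Bool) →
    IsCheckerboard G col → (x : ℤ) →
    penrose G x ≡ (-1ℤ ^ faces G) * circuitPartition (penroseMedial G col) (- x)
theorem6p2 G col chk x = begin
  penrose G x
    ≡⟨ penrose-as-sum x ⟩
  -1ℤ ^ faces G * sumℤ dartLabellings (λ s → if IsEdgeFunction G s then (- x) ^ c G s else 0ℤ)
    ≡⟨ cong (-1ℤ ^ faces G *_) (circuitPartition-as-sum (- x)) ⟨
  -1ℤ ^ faces G * circuitPartition (penroseMedial G col) (- x)
    ∎
  where
  open ≡-Reasoning
  open PenroseViaCircuits G col chk
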